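{- Let $\mathcal{F}$ be any class of MSO sentences over a finite alphabet $A$ using letter predicates, the order $\le$ and monadic predicate symbols. Then $\mathcal{F}[\le,\mathrm{Arb}_1]\cap\mathrm{REG} = \mathcal{F}[\le,\mathcal{R}eg_1]$; more precisely, for every $\varphi(P_1,\ldots,P_\ell)\in\mathcal{F}$ and monadic predicates $\mathbf{P}_1,\ldots,\mathbf{P}_\ell$ such that $L_{\varphi,\mathbf{P}_1,\ldots,\mathbf{P}_\ell}$ is regular, there are regular monadic predicates $\mathbf{Q}_1,\ldots,\mathbf{Q}_\ell$ with $L_{\varphi,\mathbf{Q}_1,\ldots,\mathbf{Q}_\ell}=L_{\varphi,\mathbf{P}_1,\ldots,\mathbf{P}_\ell}$.
   Context: A monadic predicate is $\mathbf{P}=(\mathbf{P}_n)_n$ with $\mathbf{P}_n\subseteq\{0,\ldots,n-1\}$; $\mathrm{Arb}_1$ is the class of all of them. On a word of length $n$, $P(x)$ holds iff $x\in\mathbf{P}_n$. $L_{\varphi,\mathbf{P}_1,\ldots,\mathbf{P}_\ell}=\{u\in A^*\mid u,\mathbf{P}_1,\ldots,\mathbf{P}_\ell\models\varphi\}$, and for a class of predicates $\mathcal{P}$, $\mathcal{F}[\le,\mathcal{P}]=\{L_{\varphi,\mathbf{P}_1,\ldots,\mathbf{P}_\ell}\mid\varphi\in\mathcal{F},\ \mathbf{P}_j\in\mathcal{P}\}$. $\mathrm{REG}$ is the class of regular languages. $\mathcal{R}eg_1$ is the class of regular monadic predicates: Boolean combinations of $\{c\}$, $(\{n-1-c\})_n$,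 $\{x\mid x\equiv r\bmod q\}$ and $(\{x\mid n-1\equiv r\bmod q\})_n$ for constants $c,q,r$ (equivalently, predicates definable by an MSO formula $\psi(x)$ without predicate symbols over the one-letter alphabet, via $\mathbf{Q}_n=\{x<n\mid a^n,x\models\psi\}$). -}

module Defs where

open import Data.Nat using (ℕ; zero; suc; _+_; _∸_; _≡ᵇ_; _≤ᵇ_)
open import Data.Nat.DivMod using (_%_)
open import Data.Fin using (Fin; zero; suc; toℕ)
open import Data.Bool using (Bool; true; false; not; _∧_; _∨_)
open import Data.List using (List; length; lookup; foldl)
open import Data.Product using (Σ; _×_; _,_)
open import Data.Unit using (⊤)
open import Relation.Binary.PropositionalEquality using (_≡_)

Word : ℕ → Set
Word k = List (Fin k)

Lang : ℕ → Set
Lang k = Word k → Bool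

_≐_ : ∀ {k} → Lang k → Lang k → Set
L ≐ L′ = ∀ u → L u ≡ L′ u

-- Monadic predicates: P = (P_n)_n with P_n ⊆ {0,…,n-1}

MonPred : Set
MonPred = (n : ℕ) → Fin n → Bool

Arb₁ : MonPred → Set
Arb₁ _ = ⊤

data RegExpr : Set where
  const   : ℕ → RegExpr
  fromEnd : ℕ → RegExpr
  modPos  : (q r : ℕ) → RegExpr
  modLen  : (q r : ℕ) → RegExpr
  ¬ᵉ_     : RegExpr → RegExpr
  _∧ᵉ_    : RegExpr → RegExpr → RegExpr
  _∨ᵉ_    : RegExpr → RegExpr → RegExpr

⟦_⟧ᵉ : RegExpr → MonPred
⟦ const c ⟧ᵉ n x = toℕ x ≡ᵇ c
⟦ fromEnd c ⟧ᵉ n x = (toℕ x + c + 1) ≡ᵇ n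
⟦ modPos q r ⟧ᵉ n x = (toℕ x % suc q) ≡ᵇ (r % suc q)
⟦ modLen q r ⟧ᵉ n x = ((n ∸ 1) % suc q) ≡ᵇ (r % suc q)
⟦ ¬ᵉ e ⟧ᵉ n x = not (⟦ e ⟧ᵉ n x)
⟦ e ∧ᵉ e′ ⟧ᵉ n x = ⟦ e ⟧ᵉ n x ∧ ⟦ e′ ⟧ᵉ n x
⟦ e ∨ᵉ e′ ⟧ᵉ n x = ⟦ e ⟧ᵉ n x ∨ ⟦ e′ ⟧ᵉ n x

Reg₁ : MonPred → Set
Reg₁ P = Σ RegExpr λ e → ∀ n x → P n x ≡ ⟦ e ⟧ᵉ n x

-- MSO formulas over alphabet Fin k, with ℓ monadic predicate symbols,
-- f first-order and s second-order variables in scope (de Bruijn).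

data Formula (k ℓ : ℕ) : ℕ → ℕ → Set where
  letter : ∀ {f s} → Fin k → Fin f → Formula k ℓ f s
  _≤ᶠ_   : ∀ {f s} → Fin f → Fin f → Formula k ℓ f s
  _∈ᶠ_   : ∀ {f s} → Fin f → Fin s → Formula k ℓ f s
  pred   : ∀ {f s} → Fin ℓ → Fin f → Formula k ℓ f s
  ¬ᶠ_    : ∀ {f s} → Formula k ℓ f s → Formula k ℓ f s
  _∧ᶠ_   : ∀ {f s} → Formula k ℓ f s → Formula k ℓ f s → Formula k ℓ f s
  _∨ᶠ_   : ∀ {f s} → Formula k ℓ f s → Formula k ℓ f s → Formula k ℓ f s
  ∃₁     : ∀ {f s} → Formula k ℓ (suc f) s → Formula k ℓ f s
  ∀₁     : ∀ {f s} → Formula k ℓ (suc f) s → Formula k ℓ f s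
  ∃₂     : ∀ {f s} → Formula k ℓ f (suc s) → Formula k ℓ f s
  ∀₂     : ∀ {f s} → Formula k ℓ f (suc s) → Formula k ℓ f s

Sentence : ℕ → Set
Sentence k = Σ ℕ λ ℓ → Formula k ℓ 0 0

anyFin : (n : ℕ) → (Fin n → Bool) → Bool
anyFin zero    g = false
anyFin (suc n) g = g zero ∨ anyFin n (λ i → g (suc i))

allFin : (n : ℕ) → (Fin n → Bool) → Bool
allFin zero    g = true
allFin (suc n) g = g zero ∧ allFin n (λ i → g (suc i))

cons : ∀ {A : Set} {n} → A → (Fin n → A) → Fin (suc n) → A
cons a g zero    = a
cons a g (suc i) = g i

anySub : (n : ℕ) → ((Fin n → Bool) → Bool) → Bool
anySub zero    g = g (λ ())
anySub (suc n) g = anySub n (λ X → g (cons false X)) ∨ anySub n (λ X → g (cons true X))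

allSub : (n : ℕ) → ((Fin n → Bool) → Bool) → Bool
allSub zero    g = g (λ ())
allSub (suc n) g = allSub n (λ X → g (cons false X)) ∧ allSub n (λ X → g (cons true X))

sat : ∀ {k ℓ f s} (u : Word k) → (Fin ℓ → MonPred) →
      (Fin f → Fin (length u)) → (Fin s → Fin (length u) → Bool) →
      Formula k ℓ f s → Bool
sat u Ps ρ σ (letter a x) = toℕ (lookup u (ρ x)) ≡ᵇ toℕ a
sat u Ps ρ σ (x ≤ᶠ y) = toℕ (ρ x) ≤ᵇ toℕ (ρ y)
sat u Ps ρ σ (x ∈ᶠ X) = σ X (ρ x)
sat u Ps ρ σ (pred j x) = Ps j (length u) (ρ x)
sat u Ps ρ σ (¬ᶠ φ) = not (sat u Ps ρ σ φ)
sat u Ps ρ σ (φ ∧ᶠ ψ) = sat u Ps ρ σ φ ∧ sat u Ps ρ σ ψ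
sat u Ps ρ σ (φ ∨ᶠ ψ) = sat u Ps ρ σ φ ∨ sat u Ps ρ σ ψ
sat u Ps ρ σ (∃₁ φ) = anyFin (length u) (λ i → sat u Ps (cons i ρ) σ φ)
sat u Ps ρ σ (∀₁ φ) = allFin (length u) (λ i → sat u Ps (cons i ρ) σ φ)
sat u Ps ρ σ (∃₂ φ) = anySub (length u) (λ X → sat u Ps ρ (cons X σ) φ)
sat u Ps ρ σ (∀₂ φ) = allSub (length u) (λ X → sat u Ps ρ (cons X σ) φ)

lang : ∀ {k ℓ} → Formula k ℓ 0 0 → (Fin ℓ → MonPred) → Lang k
lang φ Ps u = sat u Ps (λ ()) (λ ()) φ

record DFA (k : ℕ) : Set where
  field
    states : ℕ
    init   : Fin states
    δ      : Fin states → Fin k → Fin states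
    accept : Fin states → Bool

accepts : ∀ {k} → DFA k → Lang k
accepts M u = DFA.accept M (foldl (DFA.δ M) (DFA.init M) u)

Regular : ∀ {k} → Lang k → Set
Regular {k} L = Σ (DFA k) λ M → L ≐ accepts M

InClass : ∀ {k} → (Sentence k → Set) → (MonPred → Set) → Lang k → Set
InClass {k} 𝓕 𝒫 L =
  Σ ℕ λ ℓ → Σ (Formula k ℓ 0 0) λ φ → 𝓕 (ℓ , φ) ×
    Σ (Fin ℓ → MonPred) λ Ps → (∀ j → 𝒫 (Ps j)) × (L ≐ lang φ Ps)

module Submission where

-- Reading, at each position, the letter together with the column of bits of
-- P₁,…,P_ℓ there, the Büchi construction turns φ into a finite automaton B, so the
-- predicates only enter through the column word. If L_{φ,P} is recognised by a DFA M,
-- the column words w such that B agrees with M on (u, w) for every letter word u of the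
-- same length form a regular language G (a complemented projection), and the columns
-- of P provide a word of G of every length. Pumping inside G yields, for every length n,
-- a word of G whose letter at x depends only on min(x, C), min(n-1-x, C), x mod P and
-- (n-1) mod P: short words are copied, and a long word pumps the loop of a base word
-- of the same length mod P, where P = K! (K states) is divisible by every loop length. Each bit
-- of such a column word is a Boolean combination of the basic regular predicates.
-- Conversely, regular predicates are recognised by counters, so the compiled
-- automaton shows that L_{φ,Q} is regular.

open import Data.Nat
  using (ℕ; zero; suc; _+_; _*_; _∸_; _⊓_; _!; _≡ᵇ_; _<ᵇ_; _≤ᵇ_; _≤_; _<_; _≤?_; _<?_; s≤s; s≤s⁻¹; z≤n; z<s; s<s; NonZero)
open import Data.Nat.Properties
  using (+-assoc; +-comm; +-monoʳ-<; +-monoˡ-<; +-suc; +-∸-assoc; 1≤n!; _!≢0; <-cmp; <-irrefl; <-≤-trans;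
         <ᵇ-reflects-<; <ᵇ⇒<; <⇒<ᵇ; <⇒≢; <⇒≤; <⇒≯; <⇒≱; m+[n∸m]≡n; m+n∸m≡n; m+n∸n≡m; m+n≤o⇒m≤o; m+n≤o⇒m≤o∸n;
         m+n≤o⇒n≤o; m<m+n; m<n⇒m<1+n; m∸n≤m; m≤m+n; m≤n+m; m≤n⇒m∸n≡0; m≤n⇒m⊓n≡m; m≥n⇒m⊓n≡n; m⊓n≤n; n<1+n;
         n∸n≡0; n≤1+n; suc-injective; ≡ᵇ⇒≡; ≡⇒≡ᵇ; ≤-<-trans; ≤-antisym; ≤-pred; ≤-trans; ≤⇒≯;
         ≤∧≢⇒<; ≮⇒≥; ≰⇒≥; ⊓-assoc; ⊓-glb)
import Data.Nat.Properties as ℕ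
open import Data.Nat.DivMod
  using (_%_; _/_; _mod_; m%n<n; m≤n⇒m%n≡m; %-distribˡ-+; m%n%n≡m%n; [m+n]%n≡m%n; [m+kn]%n≡m%n;
         m∣n⇒o%n%m≡o%m; m≡m%n+[m/n]*n; m/n≡1+[m∸n]/n)
open import Data.Nat.Divisibility using (_∣_; divides; m∣m*n; ∣-trans; ∣⇒≤; m≤n⇒m!∣n!)
open import Data.Nat.GeneralisedArithmetic using (fold; iterate; iterate-is-fold)
open import Data.Nat.Tactic.RingSolver using (solve-∀)
open import Data.Fin using (Fin; zero; suc; toℕ; fromℕ<; _≟_; combine; remQuot)
open import Data.Fin.Properties using (toℕ-injective; toℕ-fromℕ<; toℕ<n; fromℕ<-toℕ; pigeonhole; remQuot-combine; 2↔Bool)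
open import Data.Bool using (Bool; true; false; not; _∧_; _∨_; _xor_; if_then_else_; T)
open import Data.Bool.Properties using (∨-identityʳ; ∨-assoc; ∧-zeroʳ; ∧-inverseʳ; not-involutive; xor-same)
open import Data.Vec using (Vec; []; _∷_)
import Data.Vec as V
open import Data.Vec.Properties using (lookup∘tabulate; tabulate-cong; tabulate∘lookup)
open import Data.List using (List; []; _∷_; length; lookup; foldl)
open import Data.Product using (Σ; _×_; _,_; proj₁; proj₂)
open import Data.Sum using (_⊎_; inj₁; inj₂)
open import Data.Unit using (tt)
open import Function using (_∘_; id; Inverse)
open import Relation.Binary.Definitions using (tri<; tri≈; tri>)
open import Relation.Nullary using (does; yes; no; ¬_; contradiction; ofʸ; ofⁿ)
open import Relation.Binary.PropositionalEquality
open import Defs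

≡-by-≡true : ∀ {a b : Bool} → (a ≡ true → b ≡ true) → (b ≡ true → a ≡ true) → a ≡ b
≡-by-≡true {false} {false} _ _ = refl
≡-by-≡true {false} {true}  _ g = g refl
≡-by-≡true {true}  {false} f _ = sym (f refl)
≡-by-≡true {true}  {true}  _ _ = refl

∧-≡true : ∀ {a b} → a ∧ b ≡ true → a ≡ true × b ≡ true
∧-≡true {true} e = refl , e

∨-≡true : ∀ {a b} → a ∨ b ≡ true → a ≡ true ⊎ b ≡ true
∨-≡true {true}  _ = inj₁ refl
∨-≡true {false} e = inj₂ e

∨-≡trueˡ : ∀ {a} b → a ≡ true → a ∨ b ≡ true
∨-≡trueˡ b refl = refl

∨-≡trueʳ : ∀ a {b} → b ≡ true → a ∨ b ≡ true
∨-≡trueʳ true  _ = refl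
∨-≡trueʳ false e = e

single : ∀ {n} → Fin n → Fin n → Bool
single i p = does (i ≟ p)

single-≡true : ∀ {n} {i p : Fin n} → single i p ≡ true → i ≡ p
single-≡true {i = i} {p} e with i ≟ p
... | yes i≡p = i≡p

single-self : ∀ {n} (i : Fin n) → single i i ≡ true
single-self i with i ≟ i
... | yes _  = refl
... | no i≢i = contradiction refl i≢i

anyFin-intro : ∀ {n} (g : Fin n → Bool) i → g i ≡ true → anyFin n g ≡ true
anyFin-intro g zero    e = ∨-≡trueˡ _ e
anyFin-intro g (suc i) e = ∨-≡trueʳ (g zero) (anyFin-intro (g ∘ suc) i e)

anyFin-elim : ∀ {n} (g : Fin n → Bool) → anyFin n g ≡ true → Σ (Fin n) λ i → g i ≡ true
anyFin-elim {suc n} g e with ∨-≡true {g zero} e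
... | inj₁ e₀ = zero , e₀
... | inj₂ e₁ with anyFin-elim (g ∘ suc) e₁
...   | i , eᵢ = suc i , eᵢ

anyFin-cong : ∀ n {g h : Fin n → Bool} → (∀ i → g i ≡ h i) → anyFin n g ≡ anyFin n h
anyFin-cong zero    _ = refl
anyFin-cong (suc n) e = cong₂ _∨_ (e zero) (anyFin-cong n (e ∘ suc))

anyFin-single : ∀ {n} (i : Fin n) (v : Fin n → Bool) → anyFin n (λ p → single i p ∧ v p) ≡ v i
anyFin-single {n} i v = ≡-by-≡true elim (λ e → anyFin-intro _ i (trans (cong (_∧ v i) (single-self i)) e))
  where
  elim : anyFin n (λ p → single i p ∧ v p) ≡ true → v i ≡ true
  elim e with anyFin-elim _ e
  ... | p , eₚ with ∧-≡true {single i p} eₚ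
  ...   | i≡p , vₚ = subst (λ q → v q ≡ true) (sym (single-≡true i≡p)) vₚ

allFin≡not-anyFin-not : ∀ n (g : Fin n → Bool) → allFin n g ≡ not (anyFin n (not ∘ g))
allFin≡not-anyFin-not zero    g = refl
allFin≡not-anyFin-not (suc n) g with g zero
... | true  = allFin≡not-anyFin-not n (g ∘ suc)
... | false = refl

cons-cong : ∀ {A : Set} {n} {a : A} {X Y : Fin n → A} → (∀ p → X p ≡ Y p) → ∀ p → cons a X p ≡ cons a Y p
cons-cong e zero    = refl
cons-cong e (suc p) = e p

cons-head-tail : ∀ {A : Set} {n} (X : Fin (suc n) → A) p → cons (X zero) (X ∘ suc) p ≡ X p
cons-head-tail X zero    = refl
cons-head-tail X (suc p) = refl

anySub-elim : ∀ n (g : (Fin n → Bool) → Bool) → anySub n g ≡ true → Σ (Fin n → Bool) λ X → g X ≡ true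
anySub-elim zero    g e = (λ ()) , e
anySub-elim (suc n) g e with ∨-≡true {anySub n (g ∘ cons false)} e
... | inj₁ e₀ = let X , eₓ = anySub-elim n (g ∘ cons false) e₀ in cons false X , eₓ
... | inj₂ e₁ = let X , eₓ = anySub-elim n (g ∘ cons true) e₁ in cons true X , eₓ

anySub-intro : ∀ n (g : (Fin n → Bool) → Bool) → (∀ {X Y} → (∀ p → X p ≡ Y p) → g X ≡ g Y) →
  ∀ X → g X ≡ true → anySub n g ≡ true
anySub-intro zero    g g-cong X e = trans (g-cong λ ()) e
anySub-intro (suc n) g g-cong X e =
  branch (X zero) (anySub-intro n _ (g-cong ∘ cons-cong) (X ∘ suc) (trans (g-cong (cons-head-tail X)) e))
  where
  branch : ∀ b → anySub n (g ∘ cons b) ≡ true → anySub (suc n) g ≡ true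
  branch false = ∨-≡trueˡ _
  branch true  = ∨-≡trueʳ _

allSub≡not-anySub-not : ∀ n (g : (Fin n → Bool) → Bool) → allSub n g ≡ not (anySub n (not ∘ g))
allSub≡not-anySub-not zero    g = sym (not-involutive _)
allSub≡not-anySub-not (suc n) g
  rewrite allSub≡not-anySub-not n (g ∘ cons false) | allSub≡not-anySub-not n (g ∘ cons true)
  with anySub n (not ∘ g ∘ cons false)
... | true  = refl
... | false = refl

-- Finite types

record Finite (S : Set) : Set where
  field
    size          : ℕ
    encode        : S → Fin size
    decode        : Fin size → S
    decode-encode : ∀ s → decode (encode s) ≡ s

  encode-injective : ∀ {s t} → encode s ≡ encode t → s ≡ t
  encode-injective {s} {t} e = trans (sym (decode-encode s)) (trans (cong decode e) (decode-encode t))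

Fin-finite : ∀ n → Finite (Fin n)
Fin-finite n = record { size = n ; encode = λ i → i ; decode = λ i → i ; decode-encode = λ _ → refl }

retract-finite : ∀ {S T : Set} → Finite T → (f : S → T) (g : T → S) → (∀ s → g (f s) ≡ s) → Finite S
retract-finite T-fin f g gf = record
  { size = size ; encode = encode ∘ f ; decode = g ∘ decode
  ; decode-encode = λ s → trans (cong g (decode-encode (f s))) (gf s) }
  where open Finite T-fin

×-finite : ∀ {S T : Set} → Finite S → Finite T → Finite (S × T)
×-finite {S} {T} S-fin T-fin = record
  { size = S.size * T.size
  ; encode = λ (s , t) → combine (S.encode s) (T.encode t)
  ; decode = decode
  ; decode-encode = λ (s , t) → trans (cong decode′ (remQuot-combine (S.encode s) (T.encode t)))
                                      (cong₂ _,_ (S.decode-encode s) (T.decode-encode t)) }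
  where
  module S = Finite S-fin
  module T = Finite T-fin
  decode′ : Fin S.size × Fin T.size → S × T
  decode′ (i , j) = S.decode i , T.decode j
  decode : Fin (S.size * T.size) → S × T
  decode = decode′ ∘ remQuot T.size

Bool-finite : Finite Bool
Bool-finite = retract-finite (Fin-finite 2) from to strictlyInverseˡ
  where open Inverse 2↔Bool

Vec-finite : ∀ {A : Set} → Finite A → ∀ n → Finite (Vec A n)
Vec-finite A-fin zero    = retract-finite (Fin-finite 1) (λ _ → zero) (λ _ → []) λ { [] → refl }
Vec-finite A-fin (suc n) = retract-finite (×-finite A-fin (Vec-finite A-fin n))
  (λ { (a ∷ v) → a , v }) (λ (a , v) → a ∷ v) λ { (a ∷ v) → refl }

-- Automata on words Fin n → A

record Automaton (A : Set) : Set₁ where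
  field
    State  : Set
    finite : Finite State
    start  : State
    step   : State → A → State
    final  : State → Bool

run : ∀ {S A : Set} → (S → A → S) → ∀ {n} → (Fin n → A) → S → S
run δ {zero}  w s = s
run δ {suc n} w s = run δ (w ∘ suc) (δ s (w zero))

accept : ∀ {A} → Automaton A → ∀ {n} → (Fin n → A) → Bool
accept M w = final (run step w start)
  where open Automaton M

run-cong : ∀ {S A : Set} (δ : S → A → S) {n} {w w′ : Fin n → A} → (∀ p → w p ≡ w′ p) →
  ∀ s → run δ w s ≡ run δ w′ s
run-cong δ {zero}  e s = refl
run-cong δ {suc n} e s rewrite e zero = run-cong δ (e ∘ suc) _

accept-cong : ∀ {A} (M : Automaton A) {n} {w w′ : Fin n → A} → (∀ p → w p ≡ w′ p) → accept M w ≡ accept M w′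
accept-cong M e = cong (Automaton.final M) (run-cong (Automaton.step M) e (Automaton.start M))

complement : ∀ {A} → Automaton A → Automaton A
complement M = record M { final = not ∘ Automaton.final M }

inverseImage : ∀ {A B} → (B → A) → Automaton A → Automaton B
inverseImage h M = record { State = State ; finite = finite ; start = start ; step = λ s b → step s (h b) ; final = final }
  where open Automaton M

accept-inverseImage : ∀ {A B} (h : B → A) (M : Automaton A) {n} (w : Fin n → B) →
  accept (inverseImage h M) w ≡ accept M (h ∘ w)
accept-inverseImage h M w = cong (Automaton.final M) (run-map (Automaton.start M) w)
  where
  run-map : ∀ s {n} (w : Fin n → _) → run (λ s b → Automaton.step M s (h b)) w s ≡ run (Automaton.step M) (h ∘ w) s
  run-map s {zero}  w = refl
  run-map s {suc n} w = run-map _ (w ∘ suc)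

product : ∀ {A} → (Bool → Bool → Bool) → Automaton A → Automaton A → Automaton A
product _⊕_ M N = record
  { State  = M.State × N.State
  ; finite = ×-finite M.finite N.finite
  ; start  = M.start , N.start
  ; step   = λ (s , t) a → M.step s a , N.step t a
  ; final  = λ (s , t) → M.final s ⊕ N.final t }
  where
  module M = Automaton M
  module N = Automaton N

accept-product : ∀ {A} _⊕_ (M N : Automaton A) {n} (w : Fin n → A) →
  accept (product _⊕_ M N) w ≡ accept M w ⊕ accept N w
accept-product _⊕_ M N w = cong (λ (s , t) → M.final s ⊕ N.final t) (run-pair w (M.start , N.start))
  where
  module M = Automaton M
  module N = Automaton N
  run-pair : ∀ {n} (w : Fin n → _) st →
    run (Automaton.step (product _⊕_ M N)) w st ≡ (run M.step w (proj₁ st) , run N.step w (proj₂ st))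
  run-pair {zero}  w st = refl
  run-pair {suc n} w st = run-pair (w ∘ suc) _

normalise : ∀ {A} → Automaton A → Automaton A
normalise M = record
  { State = Fin size ; finite = Fin-finite size ; start = encode start
  ; step = λ i a → encode (step (decode i) a) ; final = final ∘ decode }
  where
  open Automaton M
  open Finite finite

run-normalise : ∀ {A} (M : Automaton A) {n} (w : Fin n → A) s →
  run (Automaton.step (normalise M)) w (Finite.encode (Automaton.finite M) s)
    ≡ Finite.encode (Automaton.finite M) (run (Automaton.step M) w s)
run-normalise M {zero}  w s = refl
run-normalise M {suc n} w s rewrite Finite.decode-encode (Automaton.finite M) s = run-normalise M (w ∘ suc) _

accept-normalise : ∀ {A} (M : Automaton A) {n} (w : Fin n → A) → accept (normalise M) w ≡ accept M w
accept-normalise M w = trans (cong (final ∘ decode) (run-normalise M w start)) (cong final (decode-encode _))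
  where
  open Automaton M
  open Finite finite

module _ {A B C : Set} (M : Automaton B) (C-finite : Finite C) (extend : A → C → B) where
  private
    N : ℕ
    N = Finite.size (Automaton.finite M)

    δ : Fin N → B → Fin N
    δ = Automaton.step (normalise M)

    module C = Finite C-finite

    successor : Fin N → A → Fin N → Bool
    successor s a t = anyFin C.size (λ c → single (δ s (extend a (C.decode c))) t)

    successor-intro : ∀ s a c → successor s a (δ s (extend a c)) ≡ true
    successor-intro s a c = anyFin-intro _ (C.encode c)
      (subst (λ c′ → single (δ s (extend a c′)) (δ s (extend a c)) ≡ true) (sym (C.decode-encode c))
             (single-self (δ s (extend a c))))

    successor-elim : ∀ s a t → successor s a t ≡ true → Σ C λ c → δ s (extend a c) ≡ t
    successor-elim s a t e = let c , eᶜ = anyFin-elim _ e in C.decode c , single-≡true eᶜ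

    s₀ : Fin N
    s₀ = Automaton.start (normalise M)

  extendWord : ∀ {n} → (Fin n → A) → (Fin n → C) → Fin n → B
  extendWord w cs p = extend (w p) (cs p)

  projectionStep : Vec Bool N → A → Vec Bool N
  projectionStep S a = V.tabulate λ t → anyFin N λ s → V.lookup S s ∧ successor s a t

  projection : Automaton A
  projection = record
    { State = Vec Bool N ; finite = Vec-finite Bool-finite N ; start = V.tabulate (single s₀)
    ; step = projectionStep ; final = λ S → anyFin N λ t → V.lookup S t ∧ Automaton.final (normalise M) t }

  private
    reach-intro : ∀ {n} (w : Fin n → A) (cs : Fin n → C) S s → V.lookup S s ≡ true →
      V.lookup (run projectionStep w S) (run δ (extendWord w cs) s) ≡ true
    reach-intro {zero}  w cs S s e = e
    reach-intro {suc n} w cs S s e = reach-intro (w ∘ suc) (cs ∘ suc) _ _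
      (trans (lookup∘tabulate _ t) (anyFin-intro _ s (cong₂ _∧_ e (successor-intro s (w zero) (cs zero)))))
      where t = δ s (extend (w zero) (cs zero))

    reach-elim : ∀ {n} (w : Fin n → A) S t → V.lookup (run projectionStep w S) t ≡ true →
      Σ (Fin N) λ s → V.lookup S s ≡ true × Σ (Fin n → C) λ cs → run δ (extendWord w cs) s ≡ t
    reach-elim {zero}  w S t e = t , e , (λ ()) , refl
    reach-elim {suc n} w S t e with reach-elim (w ∘ suc) _ t e
    ... | s′ , e′ , cs , r with anyFin-elim _ (trans (sym (lookup∘tabulate _ s′)) e′)
    ...   | s , eₛ with ∧-≡true {V.lookup S s} eₛ
    ...     | eₗ , eₛᵤ with successor-elim s (w zero) s′ eₛᵤ
    ...       | c , refl = s , eₗ , cons c cs , r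

  accept-projection-intro : ∀ {n} (w : Fin n → A) (cs : Fin n → C) →
    accept M (extendWord w cs) ≡ true → accept projection w ≡ true
  accept-projection-intro w cs e = anyFin-intro _ (run δ (extendWord w cs) s₀)
    (cong₂ _∧_ (reach-intro w cs _ s₀ (trans (lookup∘tabulate (single s₀) s₀) (single-self s₀)))
               (trans (accept-normalise M (extendWord w cs)) e))

  accept-projection-elim : ∀ {n} (w : Fin n → A) → accept projection w ≡ true →
    Σ (Fin n → C) λ cs → accept M (extendWord w cs) ≡ true
  accept-projection-elim w e with anyFin-elim _ e
  ... | t , eₜ with ∧-≡true {V.lookup (run projectionStep w _) t} eₜ
  ...   | eᵣ , eᶠ with reach-elim w _ t eᵣ
  ...     | s , e₀ , cs , refl with single-≡true {i = s₀} (trans (sym (lookup∘tabulate _ s)) e₀)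
  ...       | refl = cs , trans (sym (accept-normalise M (extendWord w cs))) eᶠ

xor-≡false : ∀ {a b} → a xor b ≡ false → a ≡ b
xor-≡false {true}  {true}  _ = refl
xor-≡false {false} {false} _ = refl

module _ {A V : Set} (A-finite : Finite A) (B : Automaton (A × V)) (M : Automaton A) where
  private
    disagreement : Automaton (A × V)
    disagreement = product _xor_ B (inverseImage proj₁ M)

    accept-disagreement : ∀ {n} (w : Fin n → V) (cs : Fin n → A) →
      accept disagreement (λ p → cs p , w p) ≡ accept B (λ p → cs p , w p) xor accept M cs
    accept-disagreement w cs = trans (accept-product _xor_ B (inverseImage proj₁ M) (λ p → cs p , w p))
      (cong (accept B (λ p → cs p , w p) xor_) (accept-inverseImage proj₁ M (λ p → cs p , w p)))

  agreement : Automaton V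
  agreement = complement (projection disagreement A-finite (λ v a → a , v))

  accept-agreement-elim : ∀ {n} (w : Fin n → V) → accept agreement w ≡ true →
    ∀ cs → accept B (λ p → cs p , w p) ≡ accept M cs
  accept-agreement-elim w e cs with accept disagreement (λ p → cs p , w p) in d
  ... | false = xor-≡false (trans (sym (accept-disagreement w cs)) d)
  ... | true  = contradiction (trans (sym e) (cong not (accept-projection-intro disagreement A-finite (λ v a → a , v) w cs d))) λ ()

  accept-agreement-intro : ∀ {n} (w : Fin n → V) → (∀ cs → accept B (λ p → cs p , w p) ≡ accept M cs) →
    accept agreement w ≡ true
  accept-agreement-intro w agree with accept (projection disagreement A-finite (λ v a → a , v)) w in d
  ... | false = refl
  ... | true  with accept-projection-elim disagreement A-finite (λ v a → a , v) w d
  ...   | cs , dᶜ = contradiction (trans (sym dᶜ) (trans (accept-disagreement w cs)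
                      (trans (cong (_xor accept M cs) (agree cs)) (xor-same (accept M cs))))) λ ()

-- From MSO formulas to automata

anyAutomaton : Automaton Bool
anyAutomaton = record { State = Bool ; finite = Bool-finite ; start = false ; step = _∨_ ; final = λ b → b }

accept-anyAutomaton : ∀ {n} (w : Fin n → Bool) → accept anyAutomaton w ≡ anyFin n w
accept-anyAutomaton w = run-∨ w false
  where
  run-∨ : ∀ {n} (w : Fin n → Bool) b → run _∨_ w b ≡ b ∨ anyFin n w
  run-∨ {zero}  w b = sym (∨-identityʳ b)
  run-∨ {suc n} w b = trans (run-∨ (w ∘ suc) (b ∨ w zero)) (∨-assoc b (w zero) _)

private
  singletonStep : Bool × Bool → Bool → Bool × Bool
  singletonStep (seen , ok) b = seen ∨ b , ok ∧ not (seen ∧ b)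

  singletonFinal : Bool × Bool → Bool
  singletonFinal (seen , ok) = seen ∧ ok

  run-spoiled : ∀ {n} (w : Fin n → Bool) seen → singletonFinal (run singletonStep w (seen , false)) ≡ false
  run-spoiled {zero}  w seen = ∧-zeroʳ seen
  run-spoiled {suc n} w seen = run-spoiled (w ∘ suc) _

  run-seen-intro : ∀ {n} (w : Fin n → Bool) → (∀ p → w p ≡ false) →
    singletonFinal (run singletonStep w (true , true)) ≡ true
  run-seen-intro {zero}  w none = refl
  run-seen-intro {suc n} w none rewrite none zero = run-seen-intro (w ∘ suc) (none ∘ suc)

  run-seen-elim : ∀ {n} (w : Fin n → Bool) → singletonFinal (run singletonStep w (true , true)) ≡ true →
    ∀ p → w p ≡ false
  run-seen-elim {suc n} w e with w zero in w₀
  ... | true  = contradiction (trans (sym e) (run-spoiled (w ∘ suc) true)) λ ()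
  ... | false = λ { zero → w₀ ; (suc p) → run-seen-elim (w ∘ suc) e p }

  run-unseen-intro : ∀ {n} (i : Fin n) → singletonFinal (run singletonStep (single i) (false , true)) ≡ true
  run-unseen-intro {suc n} zero = run-seen-intro {n} _ λ _ → refl
  run-unseen-intro (suc i) = run-unseen-intro i

  run-unseen-elim : ∀ {n} (w : Fin n → Bool) → singletonFinal (run singletonStep w (false , true)) ≡ true →
    Σ (Fin n) λ i → ∀ p → w p ≡ single i p
  run-unseen-elim {suc n} w e with w zero in w₀
  ... | true  = zero , λ { zero → w₀ ; (suc p) → run-seen-elim (w ∘ suc) e p }
  ... | false = let i , wᵢ = run-unseen-elim (w ∘ suc) e in suc i , λ { zero → w₀ ; (suc p) → wᵢ p }

singletonAutomaton : Automaton Bool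
singletonAutomaton = record
  { State = Bool × Bool ; finite = ×-finite Bool-finite Bool-finite ; start = false , true
  ; step = singletonStep ; final = singletonFinal }

accept-singleton-intro : ∀ {n} (i : Fin n) → accept singletonAutomaton (single i) ≡ true
accept-singleton-intro = run-unseen-intro

accept-singleton-elim : ∀ {n} (w : Fin n → Bool) → accept singletonAutomaton w ≡ true →
  Σ (Fin n) λ i → ∀ p → w p ≡ single i p
accept-singleton-elim = run-unseen-elim

private
  orderStep : Bool × Bool → Bool × Bool → Bool × Bool
  orderStep (seenX , result) (x , y) = seenX ∨ x , result ∨ (y ∧ (seenX ∨ x))

  run-order-decided : ∀ {n} (w : Fin n → Bool × Bool) seenX → proj₂ (run orderStep w (seenX , true)) ≡ true
  run-order-decided {zero}  w seenX = refl
  run-order-decided {suc n} w seenX = run-order-decided (w ∘ suc) _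

  run-order-noY : ∀ {n} (xs : Fin n → Bool) seenX result →
    proj₂ (run orderStep (λ p → xs p , false) (seenX , result)) ≡ result
  run-order-noY {zero}  xs seenX result = refl
  run-order-noY {suc n} xs seenX result = trans (run-order-noY (xs ∘ suc) _ _) (∨-identityʳ result)

  run-order-seenX : ∀ {n} (xs : Fin n → Bool) (j : Fin n) result →
    proj₂ (run orderStep (λ p → xs p , single j p) (true , result)) ≡ true
  run-order-seenX {suc n} xs j       true  = run-order-decided (λ p → xs p , single j p) true
  run-order-seenX {suc n} xs zero    false = run-order-decided {n} _ _
  run-order-seenX {suc n} xs (suc j) false = run-order-seenX (xs ∘ suc) j false

  run-order : ∀ {n} (i j : Fin n) →
    proj₂ (run orderStep (λ p → single i p , single j p) (false , false)) ≡ (toℕ i ≤ᵇ toℕ j)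
  run-order {suc n} zero    zero    = run-order-decided {n} _ _
  run-order {suc n} zero    (suc j) = run-order-seenX _ j false
  run-order {suc n} (suc i) zero    = run-order-noY {n} (single i) false false
  run-order (suc i) (suc j) = trans (run-order i j) (≤ᵇ-suc (toℕ i) (toℕ j))
    where
    ≤ᵇ-suc : ∀ a b → (a ≤ᵇ b) ≡ (suc a ≤ᵇ suc b)
    ≤ᵇ-suc zero    b = refl
    ≤ᵇ-suc (suc a) b = refl

orderAutomaton : Automaton (Bool × Bool)
orderAutomaton = record
  { State = Bool × Bool ; finite = ×-finite Bool-finite Bool-finite ; start = false , false
  ; step = orderStep ; final = proj₂ }

accept-orderAutomaton : ∀ {n} (i j : Fin n) → accept orderAutomaton (λ p → single i p , single j p) ≡ (toℕ i ≤ᵇ toℕ j)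
accept-orderAutomaton = run-order

module Compilation {k ℓ : ℕ} (Γ : Set) (letterOf : Γ → Fin k)
                   (predicateAutomaton : Fin ℓ → Automaton (Γ × Bool)) where

  -- At a position: the letter, whether each first-order variable is there, and whether
  -- the position belongs to each second-order variable.
  Track : ℕ → ℕ → Set
  Track f s = Γ × Vec Bool f × Vec Bool s

  private
    addFirst : ∀ {f s} → Track f s → Bool → Track (suc f) s
    addFirst (γ , xs , Xs) b = γ , b ∷ xs , Xs

    addSecond : ∀ {f s} → Track f s → Bool → Track f (suc s)
    addSecond (γ , xs , Xs) b = γ , xs , b ∷ Xs

    newFirst : ∀ {f s} → Track (suc f) s → Bool
    newFirst (γ , xs , Xs) = V.head xs

  existsFirst : ∀ {f s} → Automaton (Track (suc f) s) → Automaton (Track f s)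
  existsFirst A = projection (product _∧_ A (inverseImage newFirst singletonAutomaton)) Bool-finite addFirst

  existsSecond : ∀ {f s} → Automaton (Track f (suc s)) → Automaton (Track f s)
  existsSecond A = projection A Bool-finite addSecond

  compile : ∀ {f s} → Formula k ℓ f s → Automaton (Track f s)
  compile (letter a x) = inverseImage (λ (γ , xs , _) → V.lookup xs x ∧ (toℕ (letterOf γ) ≡ᵇ toℕ a)) anyAutomaton
  compile (x ≤ᶠ y)     = inverseImage (λ (_ , xs , _) → V.lookup xs x , V.lookup xs y) orderAutomaton
  compile (x ∈ᶠ X)     = inverseImage (λ (_ , xs , Xs) → V.lookup xs x ∧ V.lookup Xs X) anyAutomaton
  compile (pred j x)   = inverseImage (λ (γ , xs , _) → γ , V.lookup xs x) (predicateAutomaton j)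
  compile (¬ᶠ φ)       = complement (compile φ)
  compile (φ ∧ᶠ ψ)     = product _∧_ (compile φ) (compile ψ)
  compile (φ ∨ᶠ ψ)     = product _∨_ (compile φ) (compile ψ)
  compile (∃₁ φ)       = existsFirst (compile φ)
  compile (∀₁ φ)       = complement (existsFirst (complement (compile φ)))
  compile (∃₂ φ)       = existsSecond (compile φ)
  compile (∀₂ φ)       = complement (existsSecond (complement (compile φ)))

  module Correct (annotate : (n : ℕ) → Fin n → Fin k → Γ)
                 (letterOf-annotate : ∀ n p a → letterOf (annotate n p a) ≡ a)
                 (Ps : Fin ℓ → MonPred)
                 (predicateAutomaton-correct : ∀ j n (u : Fin n → Fin k) i →
                    accept (predicateAutomaton j) (λ p → annotate n p (u p) , single i p) ≡ Ps j n i) where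

    track : ∀ {f s} (u : Word k) → (Fin f → Fin (length u)) → (Fin s → Fin (length u) → Bool) →
            Fin (length u) → Track f s
    track u ρ σ p = annotate (length u) p (lookup u p) , V.tabulate (λ x → single (ρ x) p) , V.tabulate (λ X → σ X p)

    private
      lookup-marks : ∀ {f} {n} (ρ : Fin f → Fin n) x p → V.lookup (V.tabulate (λ y → single (ρ y) p)) x ≡ single (ρ x) p
      lookup-marks ρ x p = lookup∘tabulate (λ y → single (ρ y) p) x

    existsFirst-correct : ∀ {f s} (A : Automaton (Track (suc f) s)) u ρ σ (g : Fin (length u) → Bool) →
      (∀ i → accept A (track u (cons i ρ) σ) ≡ g i) → accept (existsFirst A) (track u ρ σ) ≡ anyFin (length u) g
    existsFirst-correct A u ρ σ g A-correct = ≡-by-≡true elim intro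
      where
      S : Automaton (Track (suc _) _)
      S = inverseImage newFirst singletonAutomaton
      B : Automaton (Track (suc _) _)
      B = product _∧_ A S
      w : Fin (length u) → Track _ _
      w = track u ρ σ
      extended : (Fin (length u) → Bool) → Fin (length u) → Track (suc _) _
      extended cs p = addFirst (w p) (cs p)
      elim : accept (existsFirst A) w ≡ true → anyFin (length u) g ≡ true
      elim e with accept-projection-elim B Bool-finite addFirst w e
      ... | cs , eᵦ with ∧-≡true {accept A (extended cs)} (trans (sym (accept-product _∧_ A S (extended cs))) eᵦ)
      ...   | eₐ , eₛ with accept-singleton-elim cs (trans (sym (accept-inverseImage newFirst singletonAutomaton (extended cs))) eₛ)
      ...     | i , cs≡ = anyFin-intro g i (trans (sym (A-correct i))
                  (trans (accept-cong A λ p → cong (addFirst (w p)) (sym (cs≡ p))) eₐ))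
      intro : anyFin (length u) g ≡ true → accept (existsFirst A) w ≡ true
      intro e with anyFin-elim g e
      ... | i , gᵢ = accept-projection-intro B Bool-finite addFirst w (single i)
                       (trans (accept-product _∧_ A S (extended (single i)))
                         (cong₂ _∧_ (trans (A-correct i) gᵢ)
                                    (trans (accept-inverseImage newFirst singletonAutomaton (extended (single i)))
                                           (accept-singleton-intro i))))

    existsSecond-correct : ∀ {f s} (A : Automaton (Track f (suc s))) u ρ σ (g : (Fin (length u) → Bool) → Bool) →
      (∀ X → accept A (track u ρ (cons X σ)) ≡ g X) → accept (existsSecond A) (track u ρ σ) ≡ anySub (length u) g
    existsSecond-correct A u ρ σ g A-correct = ≡-by-≡true elim intro
      where
      g-cong : ∀ {X Y} → (∀ p → X p ≡ Y p) → g X ≡ g Y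
      g-cong {X} {Y} X≗Y = trans (sym (A-correct X))
        (trans (accept-cong A λ p → cong (addSecond (track u ρ σ p)) (X≗Y p)) (A-correct Y))
      elim : accept (existsSecond A) (track u ρ σ) ≡ true → anySub (length u) g ≡ true
      elim e with accept-projection-elim A Bool-finite addSecond (track u ρ σ) e
      ... | X , eₓ = anySub-intro _ g g-cong X (trans (sym (A-correct X)) eₓ)
      intro : anySub (length u) g ≡ true → accept (existsSecond A) (track u ρ σ) ≡ true
      intro e with anySub-elim _ g e
      ... | X , eₓ = accept-projection-intro A Bool-finite addSecond (track u ρ σ) X (trans (A-correct X) eₓ)

    compile-correct : ∀ {f s} (φ : Formula k ℓ f s) u ρ σ → accept (compile φ) (track u ρ σ) ≡ sat u Ps ρ σ φ
    compile-correct (letter a x) u ρ σ = begin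
      accept (compile (letter a x)) (track u ρ σ)
        ≡⟨ trans (accept-inverseImage _ anyAutomaton (track u ρ σ)) (accept-anyAutomaton {length u} _) ⟩
      anyFin (length u) (λ p → V.lookup (V.tabulate (λ y → single (ρ y) p)) x
                                 ∧ (toℕ (letterOf (annotate _ p (lookup u p))) ≡ᵇ toℕ a))
        ≡⟨ anyFin-cong _ (λ p → cong₂ _∧_ (lookup-marks ρ x p)
                                         (cong (λ c → toℕ c ≡ᵇ toℕ a) (letterOf-annotate _ p _))) ⟩
      anyFin (length u) (λ p → single (ρ x) p ∧ (toℕ (lookup u p) ≡ᵇ toℕ a))
        ≡⟨ anyFin-single (ρ x) _ ⟩
      sat u Ps ρ σ (letter a x) ∎
      where open ≡-Reasoning
    compile-correct (x ≤ᶠ y) u ρ σ = trans (accept-inverseImage _ orderAutomaton (track u ρ σ))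
      (trans (accept-cong orderAutomaton λ p → cong₂ _,_ (lookup-marks ρ x p) (lookup-marks ρ y p))
             (accept-orderAutomaton (ρ x) (ρ y)))
    compile-correct (x ∈ᶠ X) u ρ σ =
      trans (accept-inverseImage _ anyAutomaton (track u ρ σ)) (trans (accept-anyAutomaton {length u} _)
      (trans (anyFin-cong _ λ p → cong₂ _∧_ (lookup-marks ρ x p) (lookup∘tabulate (λ Y → σ Y p) X))
             (anyFin-single (ρ x) (σ X))))
    compile-correct (pred j x) u ρ σ = trans (accept-inverseImage _ (predicateAutomaton j) (track u ρ σ))
      (trans (accept-cong (predicateAutomaton j) λ p → cong (annotate _ p (lookup u p) ,_) (lookup-marks ρ x p))
             (predicateAutomaton-correct j (length u) (lookup u) (ρ x)))
    compile-correct (¬ᶠ φ) u ρ σ = cong not (compile-correct φ u ρ σ)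
    compile-correct (φ ∧ᶠ ψ) u ρ σ =
      trans (accept-product _∧_ (compile φ) (compile ψ) (track u ρ σ))
            (cong₂ _∧_ (compile-correct φ u ρ σ) (compile-correct ψ u ρ σ))
    compile-correct (φ ∨ᶠ ψ) u ρ σ =
      trans (accept-product _∨_ (compile φ) (compile ψ) (track u ρ σ))
            (cong₂ _∨_ (compile-correct φ u ρ σ) (compile-correct ψ u ρ σ))
    compile-correct (∃₁ φ) u ρ σ = existsFirst-correct (compile φ) u ρ σ _ λ i → compile-correct φ u (cons i ρ) σ
    compile-correct (∀₁ φ) u ρ σ =
      trans (cong not (existsFirst-correct (complement (compile φ)) u ρ σ _ λ i → cong not (compile-correct φ u (cons i ρ) σ)))
            (sym (allFin≡not-anyFin-not (length u) _))
    compile-correct (∃₂ φ) u ρ σ = existsSecond-correct (compile φ) u ρ σ _ λ X → compile-correct φ u ρ (cons X σ)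
    compile-correct (∀₂ φ) u ρ σ =
      trans (cong not (existsSecond-correct (complement (compile φ)) u ρ σ _ λ X → cong not (compile-correct φ u ρ (cons X σ))))
            (sym (allSub≡not-anySub-not (length u) _))

-- Automata for the regular monadic predicates

≡ᵇ-true⇒≡ : ∀ {m n} → (m ≡ᵇ n) ≡ true → m ≡ n
≡ᵇ-true⇒≡ {m} {n} e = ≡ᵇ⇒≡ m n (subst T (sym e) _)

≡⇒≡ᵇ-true : ∀ {m n} → m ≡ n → (m ≡ᵇ n) ≡ true
≡⇒≡ᵇ-true {m} {n} e with m ≡ᵇ n | ≡⇒≡ᵇ m n e
... | true | _ = refl

≢⇒≡ᵇ-false : ∀ {m n} → ¬ m ≡ n → (m ≡ᵇ n) ≡ false
≢⇒≡ᵇ-false {m} {n} m≢n with m ≡ᵇ n in eq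
... | true  = contradiction (≡ᵇ-true⇒≡ eq) m≢n
... | false = refl

≡ᵇ-cong : ∀ {a b c d} → (a ≡ b → c ≡ d) → (c ≡ d → a ≡ b) → (a ≡ᵇ b) ≡ (c ≡ᵇ d)
≡ᵇ-cong f g = ≡-by-≡true (≡⇒≡ᵇ-true ∘ f ∘ ≡ᵇ-true⇒≡) (≡⇒≡ᵇ-true ∘ g ∘ ≡ᵇ-true⇒≡)

<⇒<ᵇ-true : ∀ {m n} → m < n → (m <ᵇ n) ≡ true
<⇒<ᵇ-true {m} {n} m<n with m <ᵇ n | <⇒<ᵇ m<n
... | true | _ = refl

≮⇒<ᵇ-false : ∀ {m n} → ¬ m < n → (m <ᵇ n) ≡ false
≮⇒<ᵇ-false {m} {n} m≮n with m <ᵇ n in eq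
... | true  = contradiction (<ᵇ⇒< m n (subst T (sym eq) _)) m≮n
... | false = refl

⊓-≡ᵇ-below : ∀ y {C c} → c < C → (y ⊓ C ≡ᵇ c) ≡ (y ≡ᵇ c)
⊓-≡ᵇ-below y {C} {c} c<C = ≡ᵇ-cong uncap λ { refl → m≤n⇒m⊓n≡m (<⇒≤ c<C) }
  where
  uncap : y ⊓ C ≡ c → y ≡ c
  uncap e with y ≤? C
  ... | yes y≤C = trans (sym (m≤n⇒m⊓n≡m y≤C)) e
  ... | no  y≰C = contradiction (trans (sym e) (m≥n⇒m⊓n≡n (≰⇒≥ y≰C))) (<⇒≢ c<C)

⊓-≡ᵇ-top : ∀ y C → (y ⊓ C ≡ᵇ C) ≡ not (y <ᵇ C)
⊓-≡ᵇ-top y C with y <ᵇ C | <ᵇ-reflects-< y C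
... | true  | ofʸ y<C = trans (cong (_≡ᵇ C) (m≤n⇒m⊓n≡m (<⇒≤ y<C))) (≢⇒≡ᵇ-false (<⇒≢ y<C))
... | false | ofⁿ y≮C = trans (cong (_≡ᵇ C) (m≥n⇒m⊓n≡n (≮⇒≥ y≮C))) (≡⇒≡ᵇ-true {C} refl)

run-invariant : ∀ {S A : Set} (δ : S → A → S) (F : ℕ → S) {n} (w : Fin n → A) →
  (∀ p → δ (F (toℕ p)) (w p) ≡ F (suc (toℕ p))) → run δ w (F 0) ≡ F n
run-invariant δ F {zero}  w step = refl
run-invariant δ F {suc n} w step rewrite step zero = run-invariant δ (F ∘ suc) (w ∘ suc) (step ∘ suc)

iterate-invariant : ∀ {S : Set} (f : S → S) (α : ℕ → S) → (∀ x → f (α x) ≡ α (suc x)) →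
  ∀ p → iterate f (α 0) p ≡ α p
iterate-invariant f α step p = trans (sym (iterate-is-fold (α 0) f p)) (fold-α p)
  where
  fold-α : ∀ p → fold (α 0) f p ≡ α p
  fold-α zero    = refl
  fold-α (suc p) = trans (cong f (fold-α p)) (step p)

capped : (c : ℕ) → ℕ → Fin (suc c)
capped c x = fromℕ< (s≤s (m⊓n≤n x c))

toℕ-capped : ∀ c x → toℕ (capped c x) ≡ x ⊓ c
toℕ-capped c x = toℕ-fromℕ< (s≤s (m⊓n≤n x c))

cappedSuc : ∀ c → Fin (suc c) → Fin (suc c)
cappedSuc c t = capped c (suc (toℕ t))

cappedSuc-capped : ∀ c x → cappedSuc c (capped c x) ≡ capped c (suc x)
cappedSuc-capped c x = toℕ-injective (begin
  toℕ (capped c (suc (toℕ (capped c x)))) ≡⟨ toℕ-capped c _ ⟩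
  suc (toℕ (capped c x)) ⊓ c              ≡⟨ cong (λ y → suc y ⊓ c) (toℕ-capped c x) ⟩
  (suc x ⊓ suc c) ⊓ c                     ≡⟨ ⊓-assoc (suc x) (suc c) c ⟩
  suc x ⊓ (suc c ⊓ c)                     ≡⟨ cong (suc x ⊓_) (m≥n⇒m⊓n≡n (n≤1+n c)) ⟩
  suc x ⊓ c                               ≡⟨ toℕ-capped c (suc x) ⟨
  toℕ (capped c (suc x))                  ∎)
  where open ≡-Reasoning

toℕ-mod : ∀ x q → toℕ (x mod suc q) ≡ x % suc q
toℕ-mod x q = toℕ-fromℕ< (m%n<n x (suc q))

%-suc : ∀ x q → suc (x % suc q) % suc q ≡ suc x % suc q
%-suc x q = begin
  (1 + x % suc q) % suc q                 ≡⟨ %-distribˡ-+ 1 (x % suc q) (suc q) ⟩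
  (1 % suc q + x % suc q % suc q) % suc q ≡⟨ cong (λ y → (1 % suc q + y) % suc q) (m%n%n≡m%n x (suc q)) ⟩
  (1 % suc q + x % suc q) % suc q         ≡⟨ %-distribˡ-+ 1 x (suc q) ⟨
  (1 + x) % suc q                         ∎
  where open ≡-Reasoning

modSuc : ∀ q → Fin (suc q) → Fin (suc q)
modSuc q t = suc (toℕ t) mod suc q

modSuc-mod : ∀ q x → modSuc q (x mod suc q) ≡ suc x mod suc q
modSuc-mod q x = toℕ-injective (begin
  toℕ (suc (toℕ (x mod suc q)) mod suc q) ≡⟨ toℕ-mod (suc (toℕ (x mod suc q))) q ⟩
  suc (toℕ (x mod suc q)) % suc q         ≡⟨ cong (λ y → suc y % suc q) (toℕ-mod x q) ⟩
  suc (x % suc q) % suc q                 ≡⟨ %-suc x q ⟩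
  suc x % suc q                           ≡⟨ toℕ-mod (suc x) q ⟨
  toℕ (suc x mod suc q)                   ∎)
  where open ≡-Reasoning

clockAutomaton : ∀ {K} → (Fin K → Fin K) → Fin K → (Fin K → Bool) → Automaton Bool
clockAutomaton {K} tick t₀ test = record
  { State = Fin K × Bool ; finite = ×-finite (Fin-finite K) Bool-finite ; start = t₀ , false
  ; step = λ (t , r) b → tick t , r ∨ (b ∧ test t) ; final = proj₂ }

accept-clockAutomaton : ∀ {K} (tick : Fin K → Fin K) t₀ test {n} (i : Fin n) →
  accept (clockAutomaton tick t₀ test) (single i) ≡ test (iterate tick t₀ (toℕ i))
accept-clockAutomaton tick t₀ test i =
  trans (run-clock (single i) t₀ false) (anyFin-single i (λ p → test (iterate tick t₀ (toℕ p))))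
  where
  run-clock : ∀ {n} (w : Fin n → Bool) t r →
    proj₂ (run (Automaton.step (clockAutomaton tick t₀ test)) w (t , r))
      ≡ r ∨ anyFin n (λ p → w p ∧ test (iterate tick t (toℕ p)))
  run-clock {zero}  w t r = sym (∨-identityʳ r)
  run-clock {suc n} w t r = trans (run-clock (w ∘ suc) (tick t) _) (∨-assoc r _ _)

constAutomaton : ℕ → Automaton Bool
constAutomaton c = clockAutomaton (cappedSuc (suc c)) (capped (suc c) 0) (λ t → toℕ t ≡ᵇ c)

accept-constAutomaton : ∀ c {n} (i : Fin n) → accept (constAutomaton c) (single i) ≡ ⟦ const c ⟧ᵉ n i
accept-constAutomaton c i = begin
  accept (constAutomaton c) (single i)           ≡⟨ accept-clockAutomaton _ _ _ i ⟩
  toℕ (iterate _ (capped (suc c) 0) (toℕ i)) ≡ᵇ c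
    ≡⟨ cong (λ t → toℕ t ≡ᵇ c) (iterate-invariant _ _ (cappedSuc-capped (suc c)) (toℕ i)) ⟩
  toℕ (capped (suc c) (toℕ i)) ≡ᵇ c             ≡⟨ cong (_≡ᵇ c) (toℕ-capped (suc c) (toℕ i)) ⟩
  toℕ i ⊓ suc c ≡ᵇ c                            ≡⟨ ⊓-≡ᵇ-below (toℕ i) (n<1+n c) ⟩
  toℕ i ≡ᵇ c                                    ∎
  where open ≡-Reasoning

modPosAutomaton : ℕ → ℕ → Automaton Bool
modPosAutomaton q r = clockAutomaton (modSuc q) (0 mod suc q) (λ t → toℕ t ≡ᵇ r % suc q)

accept-modPosAutomaton : ∀ q r {n} (i : Fin n) → accept (modPosAutomaton q r) (single i) ≡ ⟦ modPos q r ⟧ᵉ n i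
accept-modPosAutomaton q r i = trans (accept-clockAutomaton _ _ _ i)
  (cong (_≡ᵇ r % suc q) (trans (cong toℕ (iterate-invariant _ (_mod suc q) (modSuc-mod q) (toℕ i))) (toℕ-mod (toℕ i) q)))

-- Started at q, the counter holds (p + q) mod (q+1) after p letters, hence (n ∸ 1) mod (q+1)
-- at the end.
modLenAutomaton : ℕ → ℕ → Automaton Bool
modLenAutomaton q r = record
  { State = Fin (suc q) ; finite = Fin-finite (suc q) ; start = q mod suc q
  ; step = λ t _ → modSuc q t ; final = λ t → toℕ t ≡ᵇ r % suc q }

accept-modLenAutomaton : ∀ q r {n} (w : Fin n → Bool) (i : Fin n) → accept (modLenAutomaton q r) w ≡ ⟦ modLen q r ⟧ᵉ n i
accept-modLenAutomaton q r {suc n} w _ =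
  cong (_≡ᵇ r % suc q) (begin
    toℕ (run _ w (q mod suc q))
      ≡⟨ cong toℕ (run-invariant _ (λ m → (m + q) mod suc q) w (λ p → modSuc-mod q (toℕ p + q))) ⟩
    toℕ ((suc n + q) mod suc q)   ≡⟨ toℕ-mod (suc n + q) q ⟩
    (suc n + q) % suc q           ≡⟨ cong (_% suc q) (+-suc n q) ⟨
    (n + suc q) % suc q           ≡⟨ [m+n]%n≡m%n n (suc q) ⟩
    n % suc q                     ∎)
  where open ≡-Reasoning

single-≡ᵇ : ∀ {n} (i p : Fin n) → single i p ≡ (toℕ i ≡ᵇ toℕ p)
single-≡ᵇ i p = ≡-by-≡true (λ e → ≡⇒≡ᵇ-true (cong toℕ (single-≡true {i = i} {p} e)))
                            (λ e → subst (λ p → single i p ≡ true) (toℕ-injective (≡ᵇ-true⇒≡ e)) (single-self i))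

module _ (c : ℕ) where
  private
    fromEndStep : Fin (suc (suc c)) × Bool → Bool → Fin (suc (suc c)) × Bool
    fromEndStep (t , started) b = (if started then cappedSuc (suc c) t else t) , started ∨ b

    -- The state after p letters when position I is marked: the number of letters read
    -- after the mark (capped), and whether the mark has been read.
    stateAfter : ℕ → ℕ → Fin (suc (suc c)) × Bool
    stateAfter I p = capped (suc c) (p ∸ suc I) , (I <ᵇ p)

    fromEndStep-stateAfter : ∀ I p → fromEndStep (stateAfter I p) (I ≡ᵇ p) ≡ stateAfter I (suc p)
    fromEndStep-stateAfter I p with <-cmp I p
    ... | tri< I<p _ _ rewrite <⇒<ᵇ-true I<p | <⇒<ᵇ-true (m<n⇒m<1+n I<p) =
      cong (_, true) (trans (cappedSuc-capped (suc c) (p ∸ suc I)) (cong (capped (suc c)) (sym (+-∸-assoc 1 I<p))))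
    ... | tri≈ _ refl _ rewrite ≮⇒<ᵇ-false (<-irrefl {I} refl) | ≡⇒≡ᵇ-true {I} refl | <⇒<ᵇ-true (n<1+n I) =
      cong (λ d → capped (suc c) d , true) (trans (m≤n⇒m∸n≡0 (n≤1+n I)) (sym (n∸n≡0 I)))
    ... | tri> _ _ p<I
      rewrite ≮⇒<ᵇ-false (<⇒≯ p<I) | ≢⇒≡ᵇ-false (≢-sym (<⇒≢ p<I)) | ≮⇒<ᵇ-false (λ I<p+1 → <⇒≱ I<p+1 p<I) =
      cong (λ d → capped (suc c) d , false)
           (trans (m≤n⇒m∸n≡0 (≤-trans (<⇒≤ p<I) (n≤1+n I))) (sym (m≤n⇒m∸n≡0 (<⇒≤ p<I))))

  fromEndAutomaton : Automaton Bool
  fromEndAutomaton = record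
    { State = Fin (suc (suc c)) × Bool ; finite = ×-finite (Fin-finite _) Bool-finite
    ; start = capped (suc c) 0 , false ; step = fromEndStep
    ; final = λ (t , started) → started ∧ (toℕ t ≡ᵇ c) }

  accept-fromEndAutomaton : ∀ {n} (i : Fin n) → accept fromEndAutomaton (single i) ≡ ⟦ fromEnd c ⟧ᵉ n i
  accept-fromEndAutomaton {n} i = begin
    accept fromEndAutomaton (single i)
      ≡⟨ cong (Automaton.final fromEndAutomaton)
              (run-invariant fromEndStep (stateAfter I) (single i) λ p →
                 trans (cong (fromEndStep _) (single-≡ᵇ i p)) (fromEndStep-stateAfter I (toℕ p))) ⟩
    (I <ᵇ n) ∧ (toℕ (capped (suc c) (n ∸ suc I)) ≡ᵇ c)
      ≡⟨ cong₂ (λ b d → b ∧ (d ≡ᵇ c)) (<⇒<ᵇ-true (toℕ<n i)) (toℕ-capped (suc c) (n ∸ suc I)) ⟩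
    ((n ∸ suc I) ⊓ suc c ≡ᵇ c)
      ≡⟨ ⊓-≡ᵇ-below (n ∸ suc I) (n<1+n c) ⟩
    (n ∸ suc I ≡ᵇ c)
      ≡⟨ ≡ᵇ-cong (λ e → trans (+-comm (I + c) 1) (trans (cong (suc I +_) (sym e)) (m+[n∸m]≡n (toℕ<n i))))
                 (λ e → trans (cong (_∸ suc I) (trans (sym e) (+-comm (I + c) 1))) (m+n∸m≡n (suc I) c)) ⟩
    (I + c + 1 ≡ᵇ n) ∎
    where
    open ≡-Reasoning
    I : ℕ
    I = toℕ i

regExprAutomaton : RegExpr → Automaton Bool
regExprAutomaton (const c)     = constAutomaton c
regExprAutomaton (fromEnd c)   = fromEndAutomaton c
regExprAutomaton (modPos q r)  = modPosAutomaton q r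
regExprAutomaton (modLen q r)  = modLenAutomaton q r
regExprAutomaton (¬ᵉ e)        = complement (regExprAutomaton e)
regExprAutomaton (e ∧ᵉ e′)     = product _∧_ (regExprAutomaton e) (regExprAutomaton e′)
regExprAutomaton (e ∨ᵉ e′)     = product _∨_ (regExprAutomaton e) (regExprAutomaton e′)

accept-regExprAutomaton : ∀ e {n} (i : Fin n) → accept (regExprAutomaton e) (single i) ≡ ⟦ e ⟧ᵉ n i
accept-regExprAutomaton (const c)    i = accept-constAutomaton c i
accept-regExprAutomaton (fromEnd c)  i = accept-fromEndAutomaton c i
accept-regExprAutomaton (modPos q r) i = accept-modPosAutomaton q r i
accept-regExprAutomaton (modLen q r) i = accept-modLenAutomaton q r (single i) i
accept-regExprAutomaton (¬ᵉ e)       i = cong not (accept-regExprAutomaton e i)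
accept-regExprAutomaton (e ∧ᵉ e′)    i = trans (accept-product _∧_ (regExprAutomaton e) (regExprAutomaton e′) (single i))
  (cong₂ _∧_ (accept-regExprAutomaton e i) (accept-regExprAutomaton e′ i))
accept-regExprAutomaton (e ∨ᵉ e′)    i = trans (accept-product _∨_ (regExprAutomaton e) (regExprAutomaton e′) (single i))
  (cong₂ _∨_ (accept-regExprAutomaton e i) (accept-regExprAutomaton e′ i))

toDFA : ∀ {k} → Automaton (Fin k) → DFA k
toDFA M = record { states = Finite.size (Automaton.finite M) ; init = start ; δ = step ; accept = final }
  where open Automaton (normalise M)

foldl≡run : ∀ {S A : Set} (δ : S → A → S) s (u : List A) → foldl δ s u ≡ run δ (lookup u) s
foldl≡run δ s []      = refl
foldl≡run δ s (a ∷ u) = foldl≡run δ (δ s a) u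

accepts-toDFA : ∀ {k} (M : Automaton (Fin k)) u → accepts (toDFA M) u ≡ accept M (lookup u)
accepts-toDFA M u = trans (cong (Automaton.final (normalise M)) (foldl≡run _ _ u)) (accept-normalise M (lookup u))

regularPredicates⇒regular : ∀ {k ℓ} (φ : Formula k ℓ 0 0) (Qs : Fin ℓ → MonPred) → (∀ j → Reg₁ (Qs j)) →
  Regular (lang φ Qs)
regularPredicates⇒regular {k} {ℓ} φ Qs Qs-regular = toDFA M , λ u → sym (begin
  accepts (toDFA M) u ≡⟨ accepts-toDFA M u ⟩
  accept M (lookup u) ≡⟨ accept-inverseImage _ (compile φ) (lookup u) ⟩
  accept (compile φ) (track u (λ ()) (λ ())) ≡⟨ compile-correct φ u (λ ()) (λ ()) ⟩
  lang φ Qs u ∎)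
  where
  open ≡-Reasoning
  expr : Fin ℓ → RegExpr
  expr j = proj₁ (Qs-regular j)
  open Compilation (Fin k) id (λ j → inverseImage proj₂ (regExprAutomaton (expr j)))
  open Correct (λ _ _ a → a) (λ _ _ _ → refl) Qs
    (λ j n u i → trans (accept-inverseImage proj₂ (regExprAutomaton (expr j)) (λ p → u p , single i p))
                       (trans (accept-regExprAutomaton (expr j) i) (sym (proj₂ (Qs-regular j) n i))))
  M : Automaton (Fin k)
  M = inverseImage (λ a → a , [] , []) (compile φ)

-- Regular predicates given by profile tables

⊥ᵉ : RegExpr
⊥ᵉ = const 0 ∧ᵉ (¬ᵉ const 0)

boolExpr : Bool → RegExpr
boolExpr true  = ¬ᵉ ⊥ᵉ
boolExpr false = ⊥ᵉ

⟦⊥ᵉ⟧ : ∀ n x → ⟦ ⊥ᵉ ⟧ᵉ n x ≡ false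
⟦⊥ᵉ⟧ n x = ∧-inverseʳ (toℕ x ≡ᵇ 0)

⟦boolExpr⟧ : ∀ b n x → ⟦ boolExpr b ⟧ᵉ n x ≡ b
⟦boolExpr⟧ true  n x = cong not (⟦⊥ᵉ⟧ n x)
⟦boolExpr⟧ false n x = ⟦⊥ᵉ⟧ n x

⋁ᵉ : ℕ → (ℕ → RegExpr) → RegExpr
⋁ᵉ zero    f = ⊥ᵉ
⋁ᵉ (suc D) f = ⋁ᵉ D f ∨ᵉ f D

module _ {n} (x : Fin n) where

  ⋁ᵉ-none : ∀ D (f : ℕ → RegExpr) → (∀ c → c < D → ⟦ f c ⟧ᵉ n x ≡ false) → ⟦ ⋁ᵉ D f ⟧ᵉ n x ≡ false
  ⋁ᵉ-none zero    f none = ⟦⊥ᵉ⟧ n x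
  ⋁ᵉ-none (suc D) f none = cong₂ _∨_ (⋁ᵉ-none D f λ c c<D → none c (m<n⇒m<1+n c<D)) (none D (n<1+n D))

  ⋁ᵉ-select : ∀ D (A F : ℕ → RegExpr) v → v < D → (∀ c → c < D → ⟦ A c ⟧ᵉ n x ≡ (v ≡ᵇ c)) →
    ⟦ ⋁ᵉ D (λ c → A c ∧ᵉ F c) ⟧ᵉ n x ≡ ⟦ F v ⟧ᵉ n x
  ⋁ᵉ-select (suc D) A F v v<D+1 A-sel with v ℕ.≟ D
  ... | yes refl = cong₂ _∨_
        (⋁ᵉ-none D _ λ c c<v →
           cong (_∧ ⟦ F c ⟧ᵉ n x) (trans (A-sel c (m<n⇒m<1+n c<v)) (≢⇒≡ᵇ-false (≢-sym (<⇒≢ c<v)))))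
        (cong (_∧ ⟦ F v ⟧ᵉ n x) (trans (A-sel v v<D+1) (≡⇒≡ᵇ-true {v} refl)))
  ... | no v≢D = trans
        (cong₂ _∨_ (⋁ᵉ-select D A F v (≤∧≢⇒< (≤-pred v<D+1) v≢D) λ c c<D → A-sel c (m<n⇒m<1+n c<D))
                   (cong (_∧ ⟦ F D ⟧ᵉ n x) (trans (A-sel D (n<1+n D)) (≢⇒≡ᵇ-false v≢D))))
        (∨-identityʳ _)

<ᵇ-∨-≡ᵇ : ∀ y C → (y <ᵇ C) ∨ (y ≡ᵇ C) ≡ (y <ᵇ suc C)
<ᵇ-∨-≡ᵇ zero    zero    = refl
<ᵇ-∨-≡ᵇ zero    (suc C) = refl
<ᵇ-∨-≡ᵇ (suc y) zero    = refl
<ᵇ-∨-≡ᵇ (suc y) (suc C) = <ᵇ-∨-≡ᵇ y C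

cappedAtom : (ℕ → RegExpr) → ℕ → ℕ → RegExpr
cappedAtom atom C c = if c <ᵇ C then atom c else ¬ᵉ ⋁ᵉ C atom

module _ {n} (x : Fin n) (atom : ℕ → RegExpr) (y : ℕ) (atom-sem : ∀ c → ⟦ atom c ⟧ᵉ n x ≡ (y ≡ᵇ c)) where

  ⋁ᵉ-atoms : ∀ C → ⟦ ⋁ᵉ C atom ⟧ᵉ n x ≡ (y <ᵇ C)
  ⋁ᵉ-atoms zero    = ⟦⊥ᵉ⟧ n x
  ⋁ᵉ-atoms (suc C) = trans (cong₂ _∨_ (⋁ᵉ-atoms C) (atom-sem C)) (<ᵇ-∨-≡ᵇ y C)

  ⟦cappedAtom⟧ : ∀ C c → c ≤ C → ⟦ cappedAtom atom C c ⟧ᵉ n x ≡ (y ⊓ C ≡ᵇ c)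
  ⟦cappedAtom⟧ C c c≤C with c <ᵇ C | <ᵇ-reflects-< c C
  ... | true  | ofʸ c<C = trans (atom-sem c) (sym (⊓-≡ᵇ-below y c<C))
  ... | false | ofⁿ c≮C rewrite ≤-antisym c≤C (≮⇒≥ c≮C) = trans (cong not (⋁ᵉ-atoms C)) (sym (⊓-≡ᵇ-top y C))

⟦fromEnd⟧ : ∀ {n} (x : Fin n) c → ⟦ fromEnd c ⟧ᵉ n x ≡ (n ∸ 1 ∸ toℕ x ≡ᵇ c)
⟦fromEnd⟧ {suc n} x c = ≡ᵇ-cong
  (λ e → trans (cong (_∸ toℕ x) (sym (suc-injective (trans (+-comm 1 (toℕ x + c)) e)))) (m+n∸m≡n (toℕ x) c))
  (λ e → trans (+-comm (toℕ x + c) 1) (cong suc (trans (cong (toℕ x +_) (sym e)) (m+[n∸m]≡n (≤-pred (toℕ<n x))))))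

⟦modPos⟧ : ∀ {n} (x : Fin n) {q r} → r ≤ q → ⟦ modPos q r ⟧ᵉ n x ≡ (toℕ x % suc q ≡ᵇ r)
⟦modPos⟧ x r≤q = cong (toℕ x % _ ≡ᵇ_) (m≤n⇒m%n≡m r≤q)

⟦modLen⟧ : ∀ {n} (x : Fin n) {q r} → r ≤ q → ⟦ modLen q r ⟧ᵉ n x ≡ ((n ∸ 1) % suc q ≡ᵇ r)
⟦modLen⟧ {n} x r≤q = cong ((n ∸ 1) % _ ≡ᵇ_) (m≤n⇒m%n≡m r≤q)

profileWord : ∀ {A : Set} (C q : ℕ) → (ℕ → ℕ → ℕ → ℕ → A) → ℕ → ℕ → A
profileWord C q h n x = h (x ⊓ C) ((n ∸ 1 ∸ x) ⊓ C) (x % suc q) ((n ∸ 1) % suc q)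

tableExpr : (C q : ℕ) → (ℕ → ℕ → ℕ → ℕ → Bool) → RegExpr
tableExpr C q h =
  ⋁ᵉ (suc C) λ c₁ → cappedAtom const C c₁ ∧ᵉ
  ⋁ᵉ (suc C) λ c₂ → cappedAtom fromEnd C c₂ ∧ᵉ
  ⋁ᵉ (suc q) λ r₁ → modPos q r₁ ∧ᵉ
  ⋁ᵉ (suc q) λ r₂ → modLen q r₂ ∧ᵉ boolExpr (h c₁ c₂ r₁ r₂)

⟦tableExpr⟧ : ∀ C q h {n} (x : Fin n) → ⟦ tableExpr C q h ⟧ᵉ n x ≡ profileWord C q h n (toℕ x)
⟦tableExpr⟧ C q h {n} x =
  trans (⋁ᵉ-select x (suc C) _ _ (X ⊓ C) (s≤s (m⊓n≤n X C))
           λ c c≤C → ⟦cappedAtom⟧ x const X (λ _ → refl) C c (≤-pred c≤C)) (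
  trans (⋁ᵉ-select x (suc C) _ _ (Y ⊓ C) (s≤s (m⊓n≤n Y C))
           λ c c≤C → ⟦cappedAtom⟧ x fromEnd Y (⟦fromEnd⟧ x) C c (≤-pred c≤C)) (
  trans (⋁ᵉ-select x (suc q) _ _ (X % suc q) (m%n<n X (suc q))
           λ r r≤q → ⟦modPos⟧ x (≤-pred r≤q)) (
  trans (⋁ᵉ-select x (suc q) _ _ ((n ∸ 1) % suc q) (m%n<n (n ∸ 1) (suc q))
           λ r r≤q → ⟦modLen⟧ x (≤-pred r≤q))
        (⟦boolExpr⟧ _ n x))))
  where
  X Y : ℕ
  X = toℕ x
  Y = n ∸ 1 ∸ toℕ x

-- Pumping to a uniform family of accepted words

runℕ : ∀ {S A : Set} → (S → A → S) → ℕ → (ℕ → A) → S → S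
runℕ δ zero    w s = s
runℕ δ (suc n) w s = runℕ δ n (w ∘ suc) (δ s (w 0))

module _ {S A : Set} (δ : S → A → S) where

  runℕ-cong : ∀ n {w w′ : ℕ → A} → (∀ x → x < n → w x ≡ w′ x) → ∀ s → runℕ δ n w s ≡ runℕ δ n w′ s
  runℕ-cong zero    e s = refl
  runℕ-cong (suc n) e s rewrite e 0 z<s = runℕ-cong n (λ x x<n → e (suc x) (s<s x<n)) _

  runℕ-+ : ∀ a b (w : ℕ → A) s → runℕ δ (a + b) w s ≡ runℕ δ b (λ x → w (a + x)) (runℕ δ a w s)
  runℕ-+ zero    b w s = refl
  runℕ-+ (suc a) b w s = runℕ-+ a b (w ∘ suc) _

  run≡runℕ : ∀ {n} (w : Fin n → A) (v : ℕ → A) → (∀ p → w p ≡ v (toℕ p)) → ∀ s → run δ w s ≡ runℕ δ n v s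
  run≡runℕ {zero}  w v e s = refl
  run≡runℕ {suc n} w v e s rewrite e zero = run≡runℕ (w ∘ suc) (v ∘ suc) (e ∘ suc) _

  runℕ-cycle : ∀ l (y : ℕ → A) s → runℕ δ (suc l) y s ≡ s →
    ∀ c → runℕ δ (c * suc l) (λ x → y (x % suc l)) s ≡ s
  runℕ-cycle l y s loop zero    = refl
  runℕ-cycle l y s loop (suc c) = begin
    runℕ δ (suc l + c * suc l) y′ s                           ≡⟨ runℕ-+ (suc l) (c * suc l) y′ s ⟩
    runℕ δ (c * suc l) (λ x → y′ (suc l + x)) (runℕ δ (suc l) y′ s)
      ≡⟨ cong (runℕ δ (c * suc l) _)
              (trans (runℕ-cong (suc l) (λ x x<l → cong y (m≤n⇒m%n≡m (s≤s⁻¹ x<l))) s) loop) ⟩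
    runℕ δ (c * suc l) (λ x → y′ (suc l + x)) s
      ≡⟨ runℕ-cong (c * suc l) (λ x _ → cong y (trans (cong (_% suc l) (+-comm (suc l) x)) ([m+n]%n≡m%n x (suc l)))) s ⟩
    runℕ δ (c * suc l) y′ s                                    ≡⟨ runℕ-cycle l y s loop c ⟩
    s ∎
    where
    open ≡-Reasoning
    y′ : ℕ → A
    y′ x = y (x % suc l)

  pump : ∀ (v w : ℕ → A) a l c s₀ s → runℕ δ (a + suc l) v s₀ ≡ runℕ δ a v s₀ →
    (∀ x → x < a → w x ≡ v x) →
    (∀ y → y < c * suc l → w (a + y) ≡ v (a + y % suc l)) →
    (∀ y → y < s → w (a + (c * suc l + y)) ≡ v (a + y)) →
    runℕ δ (a + (c * suc l + s)) w s₀ ≡ runℕ δ (a + s) v s₀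
  pump v w a l c s₀ s loop prefix middle suffix = begin
    runℕ δ (a + (m + s)) w s₀                                  ≡⟨ runℕ-+ a (m + s) w s₀ ⟩
    runℕ δ (m + s) (λ x → w (a + x)) (runℕ δ a w s₀)          ≡⟨ cong (runℕ δ (m + s) _) (runℕ-cong a prefix s₀) ⟩
    runℕ δ (m + s) (λ x → w (a + x)) d                        ≡⟨ runℕ-+ m s _ d ⟩
    runℕ δ s (λ x → w (a + (m + x))) (runℕ δ m (λ x → w (a + x)) d) ≡⟨ cong (runℕ δ s _) middle-returns ⟩
    runℕ δ s (λ x → w (a + (m + x))) d                        ≡⟨ runℕ-cong s suffix d ⟩
    runℕ δ s (λ x → v (a + x)) d                              ≡⟨ runℕ-+ a s v s₀ ⟨
    runℕ δ (a + s) v s₀                                       ∎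
    where
    open ≡-Reasoning
    m : ℕ
    m = c * suc l
    d : S
    d = runℕ δ a v s₀
    middle-returns : runℕ δ m (λ x → w (a + x)) d ≡ d
    middle-returns = trans (runℕ-cong m middle d)
      (runℕ-cycle l (λ x → v (a + x)) d (trans (sym (runℕ-+ a (suc l) v s₀)) loop) c)

  loop-exists : (S-fin : Finite S) (v : ℕ → A) (s₀ : S) →
    Σ ℕ λ a → Σ ℕ λ l → a + suc l ≤ Finite.size S-fin × runℕ δ (a + suc l) v s₀ ≡ runℕ δ a v s₀
  loop-exists S-fin v s₀ with pigeonhole (n<1+n (Finite.size S-fin)) (λ j → Finite.encode S-fin (runℕ δ (toℕ j) v s₀))
  ... | i , j , i<j , same = toℕ i , toℕ j ∸ suc (toℕ i) , subst (_≤ Finite.size S-fin) (sym a+l≡j) (s≤s⁻¹ (toℕ<n j))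
                           , trans (cong (λ t → runℕ δ t v s₀) a+l≡j) (sym (Finite.encode-injective S-fin same))
    where
    a+l≡j : toℕ i + suc (toℕ j ∸ suc (toℕ i)) ≡ toℕ j
    a+l≡j = trans (+-suc (toℕ i) _) (m+[n∸m]≡n i<j)

%-shift : ∀ {L P} .{{_ : NonZero L}} .{{_ : NonZero P}} a y → L ∣ P → a ≤ P →
  ((a + y) % P + (P ∸ a)) % L ≡ y % L
%-shift {L} {P} a y L∣P@(divides c P≡cL) a≤P = begin
  ((a + y) % P + (P ∸ a)) % L           ≡⟨ %-distribˡ-+ ((a + y) % P) (P ∸ a) L ⟩
  ((a + y) % P % L + (P ∸ a) % L) % L   ≡⟨ cong (λ z → (z + (P ∸ a) % L) % L) (m∣n⇒o%n%m≡o%m L P (a + y) L∣P) ⟩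
  ((a + y) % L + (P ∸ a) % L) % L       ≡⟨ %-distribˡ-+ (a + y) (P ∸ a) L ⟨
  (a + y + (P ∸ a)) % L                 ≡⟨ cong (_% L) a+y+[P∸a]≡y+cL ⟩
  (y + c * L) % L                       ≡⟨ [m+kn]%n≡m%n y c L ⟩
  y % L                                 ∎
  where
  open ≡-Reasoning
  a+y+[P∸a]≡y+cL : a + y + (P ∸ a) ≡ y + c * L
  a+y+[P∸a]≡y+cL = begin
    a + y + (P ∸ a) ≡⟨ cong (_+ (P ∸ a)) (+-comm a y) ⟩
    y + a + (P ∸ a) ≡⟨ +-assoc y a (P ∸ a) ⟩
    y + (a + (P ∸ a)) ≡⟨ cong (y +_) (trans (m+[n∸m]≡n a≤P) P≡cL) ⟩
    y + c * L ∎

⊓-sum-bound : ∀ {P C} x y → P ≤ C → P ≤ suc (x + y) → P ≤ suc (x ⊓ C + y ⊓ C)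
⊓-sum-bound {P} {C} x y P≤C P≤x+y+1 with x ≤? C | y ≤? C
... | yes x≤C | yes y≤C rewrite m≤n⇒m⊓n≡m x≤C | m≤n⇒m⊓n≡m y≤C = P≤x+y+1
... | no  x≰C | _       rewrite m≥n⇒m⊓n≡n (≰⇒≥ x≰C) = ≤-trans P≤C (≤-trans (m≤m+n C (y ⊓ C)) (n≤1+n _))
... | yes _   | no  y≰C rewrite m≥n⇒m⊓n≡n (≰⇒≥ y≰C) = ≤-trans P≤C (≤-trans (m≤n+m C (x ⊓ C)) (n≤1+n _))

n∣n! : ∀ {n} → 0 < n → n ∣ n !
n∣n! {suc n} _ = m∣m*n (n !)

module Uniformisation {V : Set} (D : Automaton V) (v₀ : V)
                      (W : (n : ℕ) → Fin n → V) (W-accepted : ∀ n → accept D (W n) ≡ true) where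
  open Automaton D

  word : ℕ → ℕ → V
  word n x with x <? n
  ... | yes x<n = W n (fromℕ< x<n)
  ... | no  _   = v₀

  word-accepted : ∀ n → final (runℕ step n (word n) start) ≡ true
  word-accepted n = trans (cong final (sym (run≡runℕ step (W n) (word n) agrees start))) (W-accepted n)
    where
    agrees : ∀ p → W n p ≡ word n (toℕ p)
    agrees p with toℕ p <? n
    ... | yes p<n = cong (W n) (sym (fromℕ<-toℕ p p<n))
    ... | no  p≮n = contradiction (toℕ<n p) p≮n

  K : ℕ
  K = Finite.size finite

  q : ℕ
  q = K ! ∸ 1

  P : ℕ
  P = suc q

  P≡K! : P ≡ K !
  P≡K! = m+[n∸m]≡n (1≤n! K)

  0<K : 0 < K
  0<K = ≤-<-trans z≤n (toℕ<n (Finite.encode finite start))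

  K≤P : K ≤ P
  K≤P = subst (K ≤_) (sym P≡K!) (∣⇒≤ {{K !≢0}} (n∣n! 0<K))

  divides-P : ∀ {l} → 0 < l → l ≤ K → l ∣ P
  divides-P 0<l l≤K = subst (_ ∣_) (sym P≡K!) (∣-trans (n∣n! 0<l) (m≤n⇒m!∣n! l≤K))

  C : ℕ
  C = P + P

  module Base (r : ℕ) where
    n₀ : ℕ
    n₀ = P + suc r % P

    v : ℕ → V
    v = word n₀

    private
      loop : Σ ℕ λ a → Σ ℕ λ l → a + suc l ≤ K × runℕ step (a + suc l) v start ≡ runℕ step a v start
      loop = loop-exists step finite v start

    a : ℕ
    a = proj₁ loop

    l : ℕ
    l = proj₁ (proj₂ loop)

    a+l≤K : a + suc l ≤ K
    a+l≤K = proj₁ (proj₂ (proj₂ loop))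

    returns : runℕ step (a + suc l) v start ≡ runℕ step a v start
    returns = proj₂ (proj₂ (proj₂ loop))

  -- A long word of length n follows the base word of length n₀ ≡ n (mod P) with its loop
  -- repeated: the first a letters and the last n₀ ∸ a letters are copied, and in between the
  -- letter at x is read off the loop at (x − a) mod (l+1), computed from x mod P without
  -- truncated subtraction because l+1 divides P.
  table : ℕ → ℕ → ℕ → ℕ → V
  table c₁ c₂ r₁ r₂ =
    if suc (c₁ + c₂) <ᵇ P then word (suc (c₁ + c₂)) c₁
    else if c₁ <ᵇ a then v c₁
    else if c₂ <ᵇ n₀ ∸ a then v (n₀ ∸ suc c₂)
    else v (a + (r₁ + (P ∸ a)) % suc l)
    where open Base r₂

  module _ {c₁ c₂ r₁ r₂ : ℕ} where
    open Base r₂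

    table-short : suc (c₁ + c₂) < P → table c₁ c₂ r₁ r₂ ≡ word (suc (c₁ + c₂)) c₁
    table-short short rewrite <⇒<ᵇ-true short = refl

    module _ (long : P ≤ suc (c₁ + c₂)) where
      private
        not-short : (suc (c₁ + c₂) <ᵇ P) ≡ false
        not-short = ≮⇒<ᵇ-false (≤⇒≯ long)

      table-prefix : c₁ < a → table c₁ c₂ r₁ r₂ ≡ v c₁
      table-prefix c₁<a rewrite not-short | <⇒<ᵇ-true c₁<a = refl

      table-suffix : a ≤ c₁ → c₂ < n₀ ∸ a → table c₁ c₂ r₁ r₂ ≡ v (n₀ ∸ suc c₂)
      table-suffix a≤c₁ c₂<s rewrite not-short | ≮⇒<ᵇ-false (≤⇒≯ a≤c₁) | <⇒<ᵇ-true c₂<s = refl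

      table-middle : a ≤ c₁ → n₀ ∸ a ≤ c₂ → table c₁ c₂ r₁ r₂ ≡ v (a + (r₁ + (P ∸ a)) % suc l)
      table-middle a≤c₁ s≤c₂ rewrite not-short | ≮⇒<ᵇ-false (≤⇒≯ a≤c₁) | ≮⇒<ᵇ-false (≤⇒≯ s≤c₂) = refl

  uniformWord : ℕ → ℕ → V
  uniformWord = profileWord C q table

  P≤C : P ≤ C
  P≤C = m≤m+n P P

  uniformWord-short-agrees : ∀ n x → x < n → n < P → uniformWord n x ≡ word n x
  uniformWord-short-agrees (suc n) x x<n n<P
    rewrite m≤n⇒m⊓n≡m {x} {C} (≤-trans (<⇒≤ x<n) (≤-trans (<⇒≤ n<P) P≤C))
          | m≤n⇒m⊓n≡m {n ∸ x} {C} (≤-trans (m∸n≤m n x) (≤-trans (n≤1+n n) (≤-trans (<⇒≤ n<P) P≤C)))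
    = trans (table-short {x} {n ∸ x} {x % P} {n % P} (subst (λ m → suc m < P) (sym x+[n∸x]≡n) n<P))
            (cong (λ m → word (suc m) x) x+[n∸x]≡n)
    where
    x+[n∸x]≡n : x + (n ∸ x) ≡ n
    x+[n∸x]≡n = m+[n∸m]≡n (s≤s⁻¹ x<n)

  uniformWord-short : ∀ n → n < P → final (runℕ step n (uniformWord n) start) ≡ true
  uniformWord-short n n<P =
    trans (cong final (runℕ-cong step n (λ x x<n → uniformWord-short-agrees n x x<n n<P) start)) (word-accepted n)

  module Long (n : ℕ) (P≤len : P ≤ suc n) where
    open Base (n % P)

    len : ℕ
    len = suc n

    t : ℕ
    t = (len ∸ P) / P

    len≡ : len ≡ n₀ + t * P
    len≡ = begin
      len                       ≡⟨ m≡m%n+[m/n]*n len P ⟩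
      len % P + len / P * P     ≡⟨ cong (λ d → len % P + d * P) (m/n≡1+[m∸n]/n P≤len) ⟩
      len % P + (P + t * P)     ≡⟨ +-assoc (len % P) P (t * P) ⟨
      len % P + P + t * P       ≡⟨ cong (_+ t * P) (+-comm (len % P) P) ⟩
      P + len % P + t * P       ≡⟨ cong (λ d → P + d + t * P) (%-suc n q) ⟨
      n₀ + t * P                ∎
      where open ≡-Reasoning

    a≤K : a ≤ K
    a≤K = m+n≤o⇒m≤o a a+l≤K

    a≤P : a ≤ P
    a≤P = ≤-trans a≤K K≤P

    a≤C : a ≤ C
    a≤C = ≤-trans a≤P P≤C

    L∣P : suc l ∣ P
    L∣P = divides-P z<s (m+n≤o⇒n≤o a a+l≤K)

    c : ℕ
    c = t * _∣_.quotient L∣P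

    m : ℕ
    m = c * suc l

    s : ℕ
    s = n₀ ∸ a

    n₀≡a+s : n₀ ≡ a + s
    n₀≡a+s = sym (m+[n∸m]≡n (≤-trans a≤P (m≤m+n P _)))

    s≤C : s ≤ C
    s≤C = ≤-trans (m∸n≤m n₀ a) (<⇒≤ (+-monoʳ-< P (m%n<n (suc (n % P)) P)))

    len≡a+[m+s] : len ≡ a + (m + s)
    len≡a+[m+s] = trans len≡ (trans (cong₂ (λ d e → d + t * e) n₀≡a+s (_∣_.equality L∣P)) (rearrange a s t _ (suc l)))
      where
      rearrange : ∀ a s t c L → a + s + t * (c * L) ≡ a + (t * c * L + s)
      rearrange = solve-∀

    long-profile : ∀ x → x < len → P ≤ suc (x ⊓ C + (n ∸ x) ⊓ C)
    long-profile x x<len = ⊓-sum-bound x (n ∸ x) P≤C (subst (P ≤_) (cong suc (sym (m+[n∸m]≡n (s≤s⁻¹ x<len)))) P≤len)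

    prefix : ∀ x → x < a → uniformWord len x ≡ v x
    prefix x x<a = trans (table-prefix {r₁ = x % P} (long-profile x x<len) (subst (_< a) (sym x⊓C≡x) x<a)) (cong v x⊓C≡x)
      where
      x⊓C≡x : x ⊓ C ≡ x
      x⊓C≡x = m≤n⇒m⊓n≡m (≤-trans (<⇒≤ x<a) a≤C)
      x<len : x < len
      x<len = subst (x <_) (sym len≡a+[m+s]) (<-≤-trans x<a (m≤m+n a (m + s)))

    middle : ∀ y → y < m → uniformWord len (a + y) ≡ v (a + y % suc l)
    middle y y<m = trans (table-middle {r₁ = x % P} (long-profile x x<len) (⊓-glb (m≤m+n a y) a≤C) (⊓-glb s≤n∸x s≤C))
                         (cong (λ d → v (a + d)) (%-shift a y L∣P a≤P))
      where
      x : ℕ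
      x = a + y
      x+s<len : x + s < len
      x+s<len = subst (x + s <_) (sym len≡a+[m+s])
        (subst (_< a + (m + s)) (sym (+-assoc a y s)) (+-monoʳ-< a (+-monoˡ-< s y<m)))
      x<len : x < len
      x<len = ≤-<-trans (m≤m+n x s) x+s<len
      s≤n∸x : s ≤ n ∸ x
      s≤n∸x = m+n≤o⇒m≤o∸n s (subst (_≤ n) (+-comm x s) (s≤s⁻¹ x+s<len))

    suffix : ∀ y → y < s → uniformWord len (a + (m + y)) ≡ v (a + y)
    suffix y y<s = trans (table-suffix {r₁ = x % P} (long-profile x x<len) (⊓-glb (m≤m+n a (m + y)) a≤C)
                                       (subst (_< s) (sym n∸x⊓C≡z) z<s′))
                         (cong v n₀∸[1+z]≡a+y)
      where
      x z : ℕ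
      x = a + (m + y)
      z = s ∸ suc y
      s≡ : s ≡ suc y + z
      s≡ = sym (m+[n∸m]≡n y<s)
      z<s′ : z < s
      z<s′ = subst (z <_) (sym s≡) (s≤s (m≤n+m z y))
      len≡x+1+z : len ≡ x + suc z
      len≡x+1+z = trans len≡a+[m+s] (trans (cong (λ d → a + (m + d)) s≡) (rearrange a m y z))
        where
        rearrange : ∀ a m y z → a + (m + (suc y + z)) ≡ a + (m + y) + suc z
        rearrange = solve-∀
      x<len : x < len
      x<len = subst (x <_) (sym len≡x+1+z) (m<m+n x z<s)
      n∸x⊓C≡z : (n ∸ x) ⊓ C ≡ z
      n∸x⊓C≡z = trans (cong (λ d → (d ∸ x) ⊓ C) (suc-injective (trans len≡x+1+z (+-suc x z))))
                      (trans (cong (_⊓ C) (m+n∸m≡n x z)) (m≤n⇒m⊓n≡m (≤-trans (<⇒≤ z<s′) s≤C)))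
      n₀∸[1+z]≡a+y : n₀ ∸ suc ((n ∸ x) ⊓ C) ≡ a + y
      n₀∸[1+z]≡a+y = begin
        n₀ ∸ suc ((n ∸ x) ⊓ C)  ≡⟨ cong (λ d → n₀ ∸ suc d) n∸x⊓C≡z ⟩
        n₀ ∸ suc z              ≡⟨ cong (_∸ suc z) (trans n₀≡a+s (cong (a +_) s≡)) ⟩
        a + (suc y + z) ∸ suc z ≡⟨ cong (_∸ suc z) (rearrange a y z) ⟩
        a + y + suc z ∸ suc z   ≡⟨ m+n∸n≡m (a + y) (suc z) ⟩
        a + y                   ∎
        where
        open ≡-Reasoning
        rearrange : ∀ a y z → a + (suc y + z) ≡ a + y + suc z
        rearrange = solve-∀

    uniformWord-long : final (runℕ step len (uniformWord len) start) ≡ true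
    uniformWord-long = trans (cong final (begin
      runℕ step len (uniformWord len) start   ≡⟨ cong (λ d → runℕ step d (uniformWord len) start) len≡a+[m+s] ⟩
      runℕ step (a + (m + s)) (uniformWord len) start
        ≡⟨ pump step v (uniformWord len) a l c start s returns prefix middle suffix ⟩
      runℕ step (a + s) v start                ≡⟨ cong (λ d → runℕ step d v start) n₀≡a+s ⟨
      runℕ step n₀ v start                     ∎)) (word-accepted n₀)
      where open ≡-Reasoning

  uniformWord-accepted : ∀ n → accept D (λ (p : Fin n) → uniformWord n (toℕ p)) ≡ true
  uniformWord-accepted n = trans (cong final (run≡runℕ step {n} _ (uniformWord n) (λ _ → refl) start)) (accepted n)
    where
    accepted : ∀ n → final (runℕ step n (uniformWord n) start) ≡ true
    accepted zero = uniformWord-short zero z<s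
    accepted (suc n) with suc n <? P
    ... | yes n<P = uniformWord-short (suc n) n<P
    ... | no  n≮P = Long.uniformWord-long n (≮⇒≥ n≮P)

record UniformFamily {V : Set} (D : Automaton V) : Set where
  field
    C q      : ℕ
    table    : ℕ → ℕ → ℕ → ℕ → V
    accepted : ∀ n → accept D (λ (p : Fin n) → profileWord C q table n (toℕ p)) ≡ true

uniformisation : ∀ {V : Set} (D : Automaton V) → V → (W : (n : ℕ) → Fin n → V) → (∀ n → accept D (W n) ≡ true) →
  UniformFamily D
uniformisation D v₀ W W-accepted = record { C = C ; q = q ; table = table ; accepted = uniformWord-accepted }
  where open Uniformisation D v₀ W W-accepted

∀-lists⇒∀-words : ∀ {A : Set} (Q : (n : ℕ) → (Fin n → A) → Set) →
  (∀ {n} {w w′ : Fin n → A} → (∀ p → w p ≡ w′ p) → Q n w → Q n w′) →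
  (∀ u → Q (length u) (lookup u)) → ∀ n w → Q n w
∀-lists⇒∀-words Q Q-cong Q-lists zero    w = Q-cong (λ ()) (Q-lists [])
∀-lists⇒∀-words Q Q-cong Q-lists (suc n) w =
  Q-cong (cons-head-tail w) (∀-lists⇒∀-words (λ m w′ → Q (suc m) (cons (w zero) w′))
    (λ e → Q-cong (cons-cong e))
    (λ u → Q-cong (sym ∘ cons-head-tail (lookup (w zero ∷ u))) (Q-lists (w zero ∷ u))) n (w ∘ suc))

dfaAutomaton : ∀ {k} → DFA k → Automaton (Fin k)
dfaAutomaton M = record { State = Fin states ; finite = Fin-finite states ; start = init ; step = δ ; final = DFA.accept M }
  where open DFA M using (states; init; δ)

accepts≡accept : ∀ {k} (M : DFA k) u → accepts M u ≡ accept (dfaAutomaton M) (lookup u)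
accepts≡accept M u = cong (DFA.accept M) (foldl≡run (DFA.δ M) (DFA.init M) u)

Column : ℕ → Set
Column ℓ = Vec Bool ℓ

column : ∀ {ℓ} → (Fin ℓ → MonPred) → (n : ℕ) → Fin n → Column ℓ
column Rs n p = V.tabulate λ j → Rs j n p

module _ {k ℓ : ℕ} (φ : Formula k ℓ 0 0) where
  private
    -- P_j is read off the j-th bit of the column, so the predicates become part of the input.
    columnAutomaton : Fin ℓ → Automaton ((Fin k × Column ℓ) × Bool)
    columnAutomaton j = inverseImage (λ ((_ , bs) , marked) → marked ∧ V.lookup bs j) anyAutomaton

    open Compilation (Fin k × Column ℓ) proj₁ columnAutomaton

  formulaAutomaton : Automaton (Fin k × Column ℓ)
  formulaAutomaton = inverseImage (λ γ → γ , [] , []) (compile φ)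

  lang≡formulaAutomaton : ∀ Rs u → lang φ Rs u ≡ accept formulaAutomaton (λ p → lookup u p , column Rs (length u) p)
  lang≡formulaAutomaton Rs u =
    sym (trans (accept-inverseImage _ (compile φ) (λ p → lookup u p , column Rs (length u) p))
               (compile-correct φ u (λ ()) (λ ())))
    where
    open Correct (λ n p a → a , column Rs n p) (λ _ _ _ → refl) Rs (λ j n a i →
      trans (accept-inverseImage _ anyAutomaton (λ p → (a p , column Rs n p) , single i p))
        (trans (accept-anyAutomaton {n} _)
          (trans (anyFin-cong n λ p → cong (single i p ∧_) (lookup∘tabulate (λ j′ → Rs j′ n p) j))
                 (anyFin-single i (λ p → Rs j n p)))))

module _ {k ℓ : ℕ} (φ : Formula k ℓ 0 0) (M : DFA k) where

  columnsAgreeing : Automaton (Column ℓ)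
  columnsAgreeing = agreement (Fin-finite k) (formulaAutomaton φ) (dfaAutomaton M)

  columnsAgreeing-intro : ∀ Rs → lang φ Rs ≐ accepts M → ∀ n → accept columnsAgreeing (column Rs n) ≡ true
  columnsAgreeing-intro Rs φ≐M n = accept-agreement-intro (Fin-finite k) (formulaAutomaton φ) (dfaAutomaton M) (column Rs n)
    (∀-lists⇒∀-words (λ n cs → accept (formulaAutomaton φ) (λ p → cs p , column Rs n p) ≡ accept (dfaAutomaton M) cs)
      (λ e agree → trans (accept-cong (formulaAutomaton φ) λ p → cong (_, _) (sym (e p)))
                         (trans agree (accept-cong (dfaAutomaton M) e)))
      (λ u → trans (sym (lang≡formulaAutomaton φ Rs u)) (trans (φ≐M u) (accepts≡accept M u)))
      n)

  columnsAgreeing-elim : ∀ Rs → (∀ n → accept columnsAgreeing (column Rs n) ≡ true) → lang φ Rs ≐ accepts M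
  columnsAgreeing-elim Rs agreeing u = begin
    lang φ Rs u                                                    ≡⟨ lang≡formulaAutomaton φ Rs u ⟩
    accept (formulaAutomaton φ) (λ p → lookup u p , column Rs (length u) p)
      ≡⟨ accept-agreement-elim (Fin-finite k) (formulaAutomaton φ) (dfaAutomaton M) _ (agreeing (length u)) (lookup u) ⟩
    accept (dfaAutomaton M) (lookup u)                             ≡⟨ accepts≡accept M u ⟨
    accepts M u                                                    ∎
    where open ≡-Reasoning

regularLanguage⇒regularPredicates : ∀ {k ℓ} (φ : Formula k ℓ 0 0) (Ps : Fin ℓ → MonPred) → Regular (lang φ Ps) →
  Σ (Fin ℓ → MonPred) λ Qs → (∀ j → Reg₁ (Qs j)) × (lang φ Qs ≐ lang φ Ps)
regularLanguage⇒regularPredicates {k} {ℓ} φ Ps (M , φ≐M) =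
  Qs , (λ j → expr j , λ _ _ → refl) , λ u → trans (Qs≐M u) (sym (φ≐M u))
  where
  open UniformFamily (uniformisation (columnsAgreeing φ M) (V.replicate ℓ false) (column Ps) (columnsAgreeing-intro φ M Ps φ≐M))
  expr : Fin ℓ → RegExpr
  expr j = tableExpr C q λ c₁ c₂ r₁ r₂ → V.lookup (table c₁ c₂ r₁ r₂) j
  Qs : Fin ℓ → MonPred
  Qs j = ⟦ expr j ⟧ᵉ
  column-Qs : ∀ n p → column Qs n p ≡ profileWord C q table n (toℕ p)
  column-Qs n p = trans (tabulate-cong λ j → ⟦tableExpr⟧ C q _ p) (tabulate∘lookup _)
  Qs≐M : lang φ Qs ≐ accepts M
  Qs≐M = columnsAgreeing-elim φ M Qs λ n →
    trans (accept-cong (columnsAgreeing φ M) {n} {column Qs n} {λ p → profileWord C q table n (toℕ p)} (column-Qs n)) (accepted n)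

mainTheorem10 : (k : ℕ) (𝓕 : Sentence k → Set) →
    -- 𝓕[≤,Arb₁] ∩ REG ⊆ 𝓕[≤,Reg₁]
    ((L : Lang k) → InClass 𝓕 Arb₁ L × Regular L → InClass 𝓕 Reg₁ L) ×
    -- 𝓕[≤,Reg₁] ⊆ 𝓕[≤,Arb₁] ∩ REG
    ((L : Lang k) → InClass 𝓕 Reg₁ L → InClass 𝓕 Arb₁ L × Regular L) ×
    -- more precisely: same formula, regular predicates replacing arbitrary ones
    ((ℓ : ℕ) (φ : Formula k ℓ 0 0) → 𝓕 (ℓ , φ) → (Ps : Fin ℓ → MonPred) →
      Regular (lang φ Ps) →
      Σ (Fin ℓ → MonPred) λ Qs → (∀ j → Reg₁ (Qs j)) × (lang φ Qs ≐ lang φ Ps))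
mainTheorem10 k 𝓕 =
  arbitrary∩regular⊆regular , regular⊆arbitrary∩regular , λ ℓ φ _ → regularLanguage⇒regularPredicates φ
  where
  arbitrary∩regular⊆regular : (L : Lang k) → InClass 𝓕 Arb₁ L × Regular L → InClass 𝓕 Reg₁ L
  arbitrary∩regular⊆regular L ((ℓ , φ , φ∈𝓕 , Ps , _ , L≐φ) , M , L≐M) =
    ℓ , φ , φ∈𝓕 , proj₁ result , proj₁ (proj₂ result) , λ u → trans (L≐φ u) (sym (proj₂ (proj₂ result) u))
    where
    result : Σ (Fin ℓ → MonPred) λ Qs → (∀ j → Reg₁ (Qs j)) × (lang φ Qs ≐ lang φ Ps)
    result = regularLanguage⇒regularPredicates φ Ps (M , λ u → trans (sym (L≐φ u)) (L≐M u))

  regular⊆arbitrary∩regular : (L : Lang k) → InClass 𝓕 Reg₁ L → InClass 𝓕 Arb₁ L × Regular L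
  regular⊆arbitrary∩regular L (ℓ , φ , φ∈𝓕 , Qs , Qs-regular , L≐φ) =
    (ℓ , φ , φ∈𝓕 , Qs , (λ _ → tt) , L≐φ) , proj₁ φ-regular , λ u → trans (L≐φ u) (proj₂ φ-regular u)
    where
    φ-regular : Regular (lang φ Qs)
    φ-regular = regularPredicates⇒regular φ Qs Qs-regular
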